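{- Let $B$ and $i$ be positive integers and let $r$ be an integer with $r\in\left(\frac{B}{2i},\frac{B}{2i-1}\right]$. Then the expected final fullness of the deferred even split strategy under random batched insertions of $r$ keys is \[\frac{2ir}{B}\left(H_{2i}-H_i\right),\] where $H_k=1+\frac12+\dots+\frac1k$ is the $k$-th harmonic number.
   Context: Keys are stored in contiguous blocks of capacity $B$. Insertions arrive in batches of $r$ keys consecutive in key order, all going into a single block; the block receiving a batch is chosen at random with probability proportional to its current number of keys (uniformly random insertion position). Deferred even splitting: if a batch is inserted into a block holding $\ell$ keys and $r+\ell\le B$ the block simply grows; if $r+\ell>B$ the block is replaced by $\lceil(r+\ell)/B\rceil$ blocks whose sizes differ by at most $1$. The process starts from a single empty block. The fullness of a block is its number of keys divided by $B$; the expected final fullness is the limit, as the number of batches tends to infinity, of the average over blocks of the fullness, where the fraction of blocks of each size is taken in expectation (i.e. $\lim_{n\to\infty} n/(B\,\mathbb{E}[X^n])$ with $n$ the total number of keys and $X^n$ the number of blocks). -}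

module Defs where

open import Data.Nat as ℕ using (ℕ; zero; suc; _≤?_; _≤_)
open import Data.Nat.DivMod using (_/_; _%_)
open import Data.Integer using (+_)
open import Data.Rational as ℚ using (ℚ; 0ℚ; _÷_; ∣_∣; _<_)
open import Data.Rational.Properties using (_≟_)
open import Data.List using (List; []; _∷_; _++_; map; replicate; length; concatMap)
open import Data.Nat.ListAction using (sum)
open import Data.Product using (_×_; _,_; ∃-syntax)
open import Relation.Nullary using (yes; no)

toℚ : ℕ → ℚ
toℚ n = (+ n) ℚ./ 1

-- total division on ℚ (x / 0 := 0); only ever applied to nonzero denominators here
_÷?_ : ℚ → ℚ → ℚ
p ÷? q with q ≟ 0ℚ
... | yes _ = 0ℚ
... | no q≢0 = _÷_ p q {{ℚ.≢-nonZero q≢0}}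

H : ℕ → ℚ
H zero = 0ℚ
H (suc k) = H k ℚ.+ ((+ 1) ℚ./ suc k)

-- ⌈ n / B ⌉  (B = 0 gives 0; never used with B = 0)
ceilDiv : ℕ → ℕ → ℕ
ceilDiv n zero = 0
ceilDiv n (suc b) = (n ℕ.+ b) / suc b

evenSplit : ℕ → ℕ → List ℕ
evenSplit n zero = []
evenSplit n (suc k) =
  replicate (n % suc k) (suc (n / suc k)) ++ replicate (suc k ℕ.∸ n % suc k) (n / suc k)

-- deferred even splitting: a batch of r keys inserted into a block of ℓ keys, capacity B
newBlocks : (B r ℓ : ℕ) → List ℕ
newBlocks B r ℓ with r ℕ.+ ℓ ≤? B
... | yes _ = (r ℕ.+ ℓ) ∷ []
... | no _  = evenSplit (r ℕ.+ ℓ) (ceilDiv (r ℕ.+ ℓ) B)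

-- A configuration is the list of block sizes.
Config : Set
Config = List ℕ

-- all ways to insert the batch: (size of receiving block, resulting configuration)
outcomes : (B r : ℕ) → Config → List (ℕ × Config)
outcomes B r [] = []
outcomes B r (ℓ ∷ s) =
  (ℓ , newBlocks B r ℓ ++ s) ∷ map (λ { (w , s') → (w , ℓ ∷ s') }) (outcomes B r s)

Dist : Set
Dist = List (ℚ × Config)

-- probability that the batch goes into a block of size ℓ in configuration s:
-- proportional to ℓ (uniform over blocks when no keys are present yet,
-- i.e. for the very first batch into the single empty block)
choiceProb : Config → ℕ → ℚ
choiceProb s ℓ with sum s
... | zero  = toℚ 1 ÷? toℚ (length s)
... | suc t = toℚ ℓ ÷? toℚ (suc t)

step : (B r : ℕ) → Dist → Dist
step B r = concatMap (λ { (p , s) →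
  map (λ { (ℓ , s') → (p ℚ.* choiceProb s ℓ , s') }) (outcomes B r s) })

dist : (B r m : ℕ) → Dist
dist B r zero = (toℚ 1 , 0 ∷ []) ∷ []
dist B r (suc m) = step B r (dist B r m)

expBlocks : (B r m : ℕ) → ℚ
expBlocks B r m = go (dist B r m)
  where
  go : Dist → ℚ
  go [] = 0ℚ
  go ((p , s) ∷ d) = p ℚ.* toℚ (length s) ℚ.+ go d

fullnessAfter : (B r m : ℕ) → ℚ
fullnessAfter B r m = toℚ (m ℕ.* r) ÷? (toℚ B ℚ.* expBlocks B r m)

ConvergesTo : (ℕ → ℚ) → ℚ → Set
ConvergesTo f L = ∀ (ε : ℚ) → 0ℚ < ε → ∃[ N ] (∀ m → N ≤ m → ∣ f m ℚ.- L ∣ < ε)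

ExpectedFinalFullness : (B r : ℕ) → ℚ → Set
ExpectedFinalFullness B r L = ConvergesTo (fullnessAfter B r) L

module Submission where

-- While (2i − 1) r ≤ B < 2ir, the first 2i batches grow the single block to (2i − 1) r keys and then
-- split it into two blocks of ir keys; from then on every block has ir + jr keys for some j < i,
-- and a batch moves a block from size (i + j′) r to (i + j) r, j′ the cyclic predecessor of j
-- (the block of (2i − 1) r keys becomes two blocks of ir keys). As the receiving block is chosen
-- with probability proportional to its size, the expected number x_m(j) of blocks of size (i + j) r
-- after m batches satisfies a linear recursion, and v_m(j) = (i + j)(i + j + 1) x_m(j) / m relaxes
-- towards v_m(j′) at rate (i + j + 1) / (m + 1). The mass Σ v_m(j) / (i + j + 1) stays 1, and by a
-- Poincaré inequality on the cycle the weighted variance shrinks by a factor 1 − c / (m + 1) per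
-- batch; as the harmonic series diverges, v_m(j) → 1 / Z with Z = H_{2i} − H_i. Therefore
-- E[X^m] / m = Σ_j v_m(j) / ((i + j)(i + j + 1)) → 1 / (2iZ), and the fullness mr / (B E[X^m])
-- tends to 2irZ / B.

open import Defs

module RationalFacts where

  open import Data.Nat as ℕ using (ℕ; suc)
  import Data.Nat.Properties as ℕ
  import Data.Integer as ℤ
  import Data.Integer.Properties as ℤ
  open import Data.Integer using (+_)
  open import Data.Rational
  open import Data.Rational.Properties
  import Data.Nat.Coprimality as Coprimality
  open import Relation.Binary.PropositionalEquality
  open import Relation.Nullary using (yes; no)
  open import Data.Empty using (⊥-elim)
  open import Data.Sum using (inj₁; inj₂)
  open import Data.Product using (_,_; ∃-syntax)
  open import Data.Rational.Solver using (module +-*-Solver)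
  open +-*-Solver

  toℚ≡mkℚ : ∀ n → toℚ n ≡ mkℚ (+ n) 0 (Coprimality.sym (Coprimality.1-coprimeTo n))
  toℚ≡mkℚ n = normalize-coprime (Coprimality.sym (Coprimality.1-coprimeTo n))

  toℚ-homo-+ : ∀ m n → toℚ (m ℕ.+ n) ≡ toℚ m + toℚ n
  toℚ-homo-+ m n = trans
    (cong (_/ 1) (trans (ℤ.pos-+ m n) (sym (cong₂ ℤ._+_ (ℤ.*-identityʳ (+ m)) (ℤ.*-identityʳ (+ n))))))
    (sym (cong₂ _+_ (toℚ≡mkℚ m) (toℚ≡mkℚ n)))

  toℚ-homo-* : ∀ m n → toℚ (m ℕ.* n) ≡ toℚ m * toℚ n
  toℚ-homo-* m n = trans (cong (_/ 1) (ℤ.pos-* m n)) (sym (cong₂ _*_ (toℚ≡mkℚ m) (toℚ≡mkℚ n)))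

  toℚ-mono-≤ : ∀ {m n} → m ℕ.≤ n → toℚ m ≤ toℚ n
  toℚ-mono-≤ {m} {n} m≤n rewrite toℚ≡mkℚ m | toℚ≡mkℚ n =
    *≤* (subst₂ ℤ._≤_ (sym (ℤ.*-identityʳ (+ m))) (sym (ℤ.*-identityʳ (+ n))) (ℤ.+≤+ m≤n))

  toℚ-mono-< : ∀ {m n} → m ℕ.< n → toℚ m < toℚ n
  toℚ-mono-< {m} {n} m<n rewrite toℚ≡mkℚ m | toℚ≡mkℚ n =
    *<* (subst₂ ℤ._<_ (sym (ℤ.*-identityʳ (+ m))) (sym (ℤ.*-identityʳ (+ n))) (ℤ.+<+ m<n))

  toℚ-nonNeg : ∀ n → 0ℚ ≤ toℚ n
  toℚ-nonNeg n = toℚ-mono-≤ {0} {n} ℕ.z≤n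

  toℚ-pos : ∀ n → 0ℚ < toℚ (suc n)
  toℚ-pos n = toℚ-mono-< {0} {suc n} ℕ.z<s

  1/ℕ : (n : ℕ) → .{{ℕ.NonZero n}} → ℚ
  1/ℕ n = (+ 1) / n

  1/ℕ≡mkℚ : ∀ n → 1/ℕ (suc n) ≡ mkℚ (+ 1) n (Coprimality.1-coprimeTo (suc n))
  1/ℕ≡mkℚ n = normalize-coprime (Coprimality.1-coprimeTo (suc n))

  toℚ*1/ℕ≡1 : ∀ n .{{_ : ℕ.NonZero n}} → toℚ n * 1/ℕ n ≡ 1ℚ
  toℚ*1/ℕ≡1 (suc n) rewrite toℚ≡mkℚ (suc n) | 1/ℕ≡mkℚ n =
    *-inverseʳ (mkℚ (+ suc n) 0 (Coprimality.sym (Coprimality.1-coprimeTo (suc n))))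

  1/ℕ*toℚ≡1 : ∀ n .{{_ : ℕ.NonZero n}} → 1/ℕ n * toℚ n ≡ 1ℚ
  1/ℕ*toℚ≡1 n = trans (*-comm (1/ℕ n) (toℚ n)) (toℚ*1/ℕ≡1 n)

  inverse-unique : ∀ q x y → q * x ≡ 1ℚ → q * y ≡ 1ℚ → x ≡ y
  inverse-unique q x y qx≡1 qy≡1 = begin
    x            ≡⟨ sym (*-identityˡ x) ⟩
    1ℚ * x       ≡⟨ cong (_* x) (sym qy≡1) ⟩
    (q * y) * x  ≡⟨ solve 3 (λ q x y → (q :* y) :* x := y :* (q :* x)) refl q x y ⟩
    y * (q * x)  ≡⟨ cong (y *_) qx≡1 ⟩
    y * 1ℚ       ≡⟨ *-identityʳ y ⟩
    y            ∎
    where open ≡-Reasoning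

  1/ℕ-homo-* : ∀ m n → 1/ℕ (suc m ℕ.* suc n) ≡ 1/ℕ (suc m) * 1/ℕ (suc n)
  1/ℕ-homo-* m n = inverse-unique (toℚ (suc m ℕ.* suc n)) _ _ (toℚ*1/ℕ≡1 (suc m ℕ.* suc n)) (begin
    toℚ (suc m ℕ.* suc n) * (1/ℕ (suc m) * 1/ℕ (suc n))
      ≡⟨ cong (_* (1/ℕ (suc m) * 1/ℕ (suc n))) (toℚ-homo-* (suc m) (suc n)) ⟩
    toℚ (suc m) * toℚ (suc n) * (1/ℕ (suc m) * 1/ℕ (suc n))
      ≡⟨ solve 4 (λ p q x y → (p :* q) :* (x :* y) := (p :* x) :* (q :* y))
           refl (toℚ (suc m)) (toℚ (suc n)) (1/ℕ (suc m)) (1/ℕ (suc n)) ⟩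
    (toℚ (suc m) * 1/ℕ (suc m)) * (toℚ (suc n) * 1/ℕ (suc n))
      ≡⟨ cong₂ _*_ (toℚ*1/ℕ≡1 (suc m)) (toℚ*1/ℕ≡1 (suc n)) ⟩
    1ℚ ∎)
    where open ≡-Reasoning

  1/ℕ-suc-sub : ∀ m → 1/ℕ (suc m) - 1/ℕ (suc (suc m)) ≡ 1/ℕ (suc m) * 1/ℕ (suc (suc m))
  1/ℕ-suc-sub m = begin
    a - b                                    ≡⟨ solve 2 (λ a b → a :- b := a :* con 1ℚ :- b :* con 1ℚ) refl a b ⟩
    a * 1ℚ - b * 1ℚ                          ≡⟨ cong₂ (λ u w → a * u - b * w) (sym (toℚ*1/ℕ≡1 (suc (suc m)))) (sym (toℚ*1/ℕ≡1 (suc m))) ⟩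
    a * (toℚ (suc (suc m)) * b) - b * (q * a) ≡⟨ cong (λ z → a * (z * b) - b * (q * a)) (toℚ-homo-+ 1 (suc m)) ⟩
    a * ((1ℚ + q) * b) - b * (q * a)        ≡⟨ solve 3 (λ a b q → a :* ((con 1ℚ :+ q) :* b) :- b :* (q :* a) := a :* b) refl a b q ⟩
    a * b                                    ∎
    where
    open ≡-Reasoning
    a = 1/ℕ (suc m)
    b = 1/ℕ (suc (suc m))
    q = toℚ (suc m)

  1/ℕ-pos : ∀ n → 0ℚ < 1/ℕ (suc n)
  1/ℕ-pos n rewrite 1/ℕ≡mkℚ n = positive⁻¹ _

  1/ℕ-nonNeg : ∀ n → 0ℚ ≤ 1/ℕ (suc n)
  1/ℕ-nonNeg n = <⇒≤ (1/ℕ-pos n)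

  1/ℕ-antimono-≤ : ∀ {m n} → m ℕ.≤ n → 1/ℕ (suc n) ≤ 1/ℕ (suc m)
  1/ℕ-antimono-≤ {m} {n} m≤n rewrite 1/ℕ≡mkℚ m | 1/ℕ≡mkℚ n =
    *≤* (subst₂ ℤ._≤_ (sym (ℤ.*-identityˡ _)) (sym (ℤ.*-identityˡ _)) (ℤ.+≤+ (ℕ.s≤s m≤n)))

  1/ℕ≤1 : ∀ n → 1/ℕ (suc n) ≤ 1ℚ
  1/ℕ≤1 n = 1/ℕ-antimono-≤ {0} {n} ℕ.z≤n

  ½*½≡¼ : 1/ℕ 2 * 1/ℕ 2 ≡ 1/ℕ 4
  ½*½≡¼ = refl

  ½+½≡1 : 1/ℕ 2 + 1/ℕ 2 ≡ 1ℚ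
  ½+½≡1 = refl

  ÷?≡÷ : ∀ p q (q≢0 : q ≢ 0ℚ) → p ÷? q ≡ (p ÷ q) {{≢-nonZero q≢0}}
  ÷?≡÷ p q q≢0 with q ≟ 0ℚ
  ... | yes q≡0 = ⊥-elim (q≢0 q≡0)
  ... | no _    = refl

  ÷?-toℚ : ∀ p n .{{_ : ℕ.NonZero n}} → p ÷? toℚ n ≡ p * 1/ℕ n
  ÷?-toℚ p (suc n) = trans (÷?≡÷ p (toℚ (suc n)) n≢0)
    (cong (p *_) (inverse-unique (toℚ (suc n)) _ _ (*-inverseʳ (toℚ (suc n)) {{≢-nonZero n≢0}}) (toℚ*1/ℕ≡1 (suc n))))
    where
    n≢0 : toℚ (suc n) ≢ 0ℚ
    n≢0 = ≢-sym (<⇒≢ (toℚ-pos n))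

  ÷?-*-cancel : ∀ p q → 0ℚ < q → (p ÷? q) * q ≡ p
  ÷?-*-cancel p q 0<q = begin
    (p ÷? q) * q                       ≡⟨ cong (_* q) (÷?≡÷ p q (≢-sym (<⇒≢ 0<q))) ⟩
    (p * (1/ q) {{q≢0}}) * q           ≡⟨ *-assoc p _ q ⟩
    p * ((1/ q) {{q≢0}} * q)           ≡⟨ cong (p *_) (*-inverseˡ q {{q≢0}}) ⟩
    p * 1ℚ                             ≡⟨ *-identityʳ p ⟩
    p                                  ∎
    where
    open ≡-Reasoning
    q≢0 = >-nonZero 0<q

  0≤q-p⇒p≤q : ∀ p q → 0ℚ ≤ q - p → p ≤ q
  0≤q-p⇒p≤q p q 0≤q-p = subst₂ _≤_ (+-identityʳ p) (solve 2 (λ p q → p :+ (q :- p) := q) refl p q) (+-monoʳ-≤ p 0≤q-p)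

  p≤q⇒0≤q-p : ∀ p q → p ≤ q → 0ℚ ≤ q - p
  p≤q⇒0≤q-p p q p≤q = subst (_≤ q - p) (+-inverseʳ p) (+-monoˡ-≤ (- p) p≤q)

  p≤p+q : ∀ p {q} → 0ℚ ≤ q → p ≤ p + q
  p≤p+q p 0≤q = subst (_≤ p + _) (+-identityʳ p) (+-monoʳ-≤ p 0≤q)

  *-nonNeg : ∀ p q → 0ℚ ≤ p → 0ℚ ≤ q → 0ℚ ≤ p * q
  *-nonNeg p q 0≤p 0≤q = nonNegative⁻¹ _ {{nonNeg*nonNeg⇒nonNeg p {{nonNegative 0≤p}} q {{nonNegative 0≤q}}}}

  +-nonNeg : ∀ p q → 0ℚ ≤ p → 0ℚ ≤ q → 0ℚ ≤ p + q
  +-nonNeg p q 0≤p 0≤q = +-mono-≤ 0≤p 0≤q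

  *-pos : ∀ p q → 0ℚ < p → 0ℚ < q → 0ℚ < p * q
  *-pos p q 0<p 0<q = positive⁻¹ (p * q) {{pos*pos⇒pos p {{positive 0<p}} q {{positive 0<q}}}}

  1/-pos : ∀ p (0<p : 0ℚ < p) → 0ℚ < (1/ p) {{>-nonZero 0<p}}
  1/-pos p 0<p = positive⁻¹ _ {{1/pos⇒pos p {{positive 0<p}}}}

  *-monoˡ-≤-0≤ : ∀ r {p q} → 0ℚ ≤ r → p ≤ q → r * p ≤ r * q
  *-monoˡ-≤-0≤ r 0≤r p≤q = *-monoˡ-≤-nonNeg r {{nonNegative 0≤r}} p≤q

  *-monoʳ-≤-0≤ : ∀ r {p q} → 0ℚ ≤ r → p ≤ q → p * r ≤ q * r
  *-monoʳ-≤-0≤ r 0≤r p≤q = *-monoʳ-≤-nonNeg r {{nonNegative 0≤r}} p≤q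

  *-mono-≤-0≤ : ∀ {p q r s} → 0ℚ ≤ p → 0ℚ ≤ r → p ≤ q → r ≤ s → p * r ≤ q * s
  *-mono-≤-0≤ {p} {q} {r} {s} 0≤p 0≤r p≤q r≤s =
    ≤-trans (*-monoʳ-≤-0≤ r 0≤r p≤q) (*-monoˡ-≤-0≤ q (≤-trans 0≤p p≤q) r≤s)

  archimedean : ∀ p → ∃[ n ] p < toℚ n
  archimedean (mkℚ (+ a) d c) = suc a , subst (mkℚ (+ a) d c <_) (sym (toℚ≡mkℚ (suc a)))
    (*<* (subst₂ ℤ._<_ (sym (ℤ.*-identityʳ (+ a))) (ℤ.pos-* (suc a) (suc d))
      (ℤ.+<+ (ℕ.s≤s (ℕ.≤-trans (ℕ.m≤m*n a (suc d)) (ℕ.m≤n+m (a ℕ.* suc d) d))))))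
  archimedean (mkℚ ℤ.-[1+ a ] d c) = 1 , <-trans (negative⁻¹ _) (toℚ-pos 0)

  square-nonNeg : ∀ p → 0ℚ ≤ p * p
  square-nonNeg p with ∣p∣≡p∨∣p∣≡-p p
  ... | inj₁ ∣p∣≡p  = subst (λ z → 0ℚ ≤ z * z) ∣p∣≡p (*-nonNeg ∣ p ∣ ∣ p ∣ (0≤∣p∣ p) (0≤∣p∣ p))
  ... | inj₂ ∣p∣≡-p = subst (0ℚ ≤_) (trans (cong₂ _*_ ∣p∣≡-p ∣p∣≡-p) (solve 1 (λ p → (:- p) :* (:- p) := p :* p) refl p))
                        (*-nonNeg ∣ p ∣ ∣ p ∣ (0≤∣p∣ p) (0≤∣p∣ p))

  ∣p∣<q-of-squares : ∀ p q → 0ℚ < q → p * p < q * q → ∣ p ∣ < q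
  ∣p∣<q-of-squares p q 0<q p²<q² with ∣ p ∣ <? q
  ... | yes ∣p∣<q = ∣p∣<q
  ... | no ∣p∣≮q  = ⊥-elim (<-irrefl refl (≤-<-trans q²≤p² p²<q²))
    where
    q≤∣p∣ = ≮⇒≥ ∣p∣≮q
    ∣p∣²≡p² : ∣ p ∣ * ∣ p ∣ ≡ p * p
    ∣p∣²≡p² = trans (sym (∣p*q∣≡∣p∣*∣q∣ p p)) (0≤p⇒∣p∣≡p (square-nonNeg p))
    q²≤p² : q * q ≤ p * p
    q²≤p² = subst (q * q ≤_) ∣p∣²≡p² (*-mono-≤-0≤ (<⇒≤ 0<q) (<⇒≤ 0<q) q≤∣p∣ q≤∣p∣)

  half≤-of-near : ∀ x y → 0ℚ < y → (x - y) * (x - y) < y * y * 1/ℕ 4 → y * 1/ℕ 2 ≤ x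
  half≤-of-near x y 0<y near with x <? y * 1/ℕ 2
  ... | no x≮h  = ≮⇒≥ x≮h
  ... | yes x<h = ⊥-elim (<-irrefl refl (<-trans near (subst₂ _<_ h²≡ d²≡ h²<d²)))
    where
    h = y * 1/ℕ 2
    d = y - x
    0<h : 0ℚ < h
    0<h = *-pos y (1/ℕ 2) 0<y (1/ℕ-pos 1)
    y-h≡h : y - h ≡ h
    y-h≡h = begin
      y - y * t                     ≡⟨ solve 2 (λ y t → y :- y :* t := y :* t :+ y :* (con 1ℚ :- (t :+ t))) refl y t ⟩
      y * t + y * (1ℚ - (t + t))    ≡⟨ cong (λ z → y * t + y * (1ℚ - z)) ½+½≡1 ⟩
      y * t + y * (1ℚ - 1ℚ)         ≡⟨ solve 2 (λ y t → y :* t :+ y :* (con 1ℚ :- con 1ℚ) := y :* t) refl y t ⟩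
      y * t                         ∎
      where
      open ≡-Reasoning
      t = 1/ℕ 2
    h<d : h < d
    h<d = subst (_< d) y-h≡h (+-monoʳ-< y (neg-antimono-< x<h))
    h²<d² : h * h < d * d
    h²<d² = ≤-<-trans (*-monoˡ-≤-0≤ h (<⇒≤ 0<h) (<⇒≤ h<d)) (*-monoˡ-<-pos d {{positive (<-trans 0<h h<d)}} h<d)
    h²≡ : h * h ≡ y * y * 1/ℕ 4
    h²≡ = trans (solve 2 (λ y t → (y :* t) :* (y :* t) := y :* y :* (t :* t)) refl y (1/ℕ 2)) (cong (y * y *_) ½*½≡¼)
    d²≡ : d * d ≡ (x - y) * (x - y)
    d²≡ = solve 2 (λ x y → (y :- x) :* (y :- x) := (x :- y) :* (x :- y)) refl x y

module FiniteSums where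

  open RationalFacts
  open import Data.Nat as ℕ using (ℕ; zero; suc)
  import Data.Nat.Properties as ℕ
  open import Data.Rational
  open import Data.Rational.Properties
  open import Relation.Binary.PropositionalEquality
  open import Relation.Nullary using (yes; no)
  open import Data.Sum using (inj₁; inj₂)
  open import Data.Rational.Solver using (module +-*-Solver)
  open +-*-Solver

  Σ : ℕ → (ℕ → ℚ) → ℚ
  Σ zero    f = 0ℚ
  Σ (suc t) f = Σ t f + f t

  Σ-cong : ∀ t {f g : ℕ → ℚ} → (∀ j → j ℕ.< t → f j ≡ g j) → Σ t f ≡ Σ t g
  Σ-cong zero    f≡g = refl
  Σ-cong (suc t) f≡g = cong₂ _+_ (Σ-cong t (λ j j<t → f≡g j (ℕ.m<n⇒m<1+n j<t))) (f≡g t ℕ.≤-refl)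

  Σ-+ : ∀ t (f g : ℕ → ℚ) → Σ t (λ j → f j + g j) ≡ Σ t f + Σ t g
  Σ-+ zero    f g = refl
  Σ-+ (suc t) f g = trans (cong (_+ (f t + g t)) (Σ-+ t f g))
    (solve 4 (λ a b c d → (a :+ b) :+ (c :+ d) := (a :+ c) :+ (b :+ d)) refl (Σ t f) (Σ t g) (f t) (g t))

  Σ-*ˡ : ∀ t c (f : ℕ → ℚ) → Σ t (λ j → c * f j) ≡ c * Σ t f
  Σ-*ˡ zero    c f = sym (*-zeroʳ c)
  Σ-*ˡ (suc t) c f = trans (cong (_+ c * f t) (Σ-*ˡ t c f)) (sym (*-distribˡ-+ c (Σ t f) (f t)))

  Σ-neg : ∀ t (f : ℕ → ℚ) → Σ t (λ j → - f j) ≡ - Σ t f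
  Σ-neg zero    f = refl
  Σ-neg (suc t) f = trans (cong (_+ - f t) (Σ-neg t f)) (sym (neg-distrib-+ (Σ t f) (f t)))

  Σ-- : ∀ t (f g : ℕ → ℚ) → Σ t (λ j → f j - g j) ≡ Σ t f - Σ t g
  Σ-- t f g = trans (Σ-+ t f (λ j → - g j)) (cong (Σ t f +_) (Σ-neg t g))

  Σ-0 : ∀ t → Σ t (λ _ → 0ℚ) ≡ 0ℚ
  Σ-0 zero    = refl
  Σ-0 (suc t) = trans (+-identityʳ _) (Σ-0 t)

  Σ-const : ∀ t c → Σ t (λ _ → c) ≡ toℚ t * c
  Σ-const zero    c = sym (*-zeroˡ c)
  Σ-const (suc t) c = begin
    Σ t (λ _ → c) + c    ≡⟨ cong (_+ c) (Σ-const t c) ⟩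
    toℚ t * c + c        ≡⟨ solve 2 (λ T c → T :* c :+ c := (con 1ℚ :+ T) :* c) refl (toℚ t) c ⟩
    (1ℚ + toℚ t) * c     ≡⟨ cong (_* c) (sym (toℚ-homo-+ 1 t)) ⟩
    toℚ (suc t) * c      ∎
    where open ≡-Reasoning

  Σ-mono-≤ : ∀ t {f g : ℕ → ℚ} → (∀ j → j ℕ.< t → f j ≤ g j) → Σ t f ≤ Σ t g
  Σ-mono-≤ zero    f≤g = ≤-refl
  Σ-mono-≤ (suc t) f≤g = +-mono-≤ (Σ-mono-≤ t (λ j j<t → f≤g j (ℕ.m<n⇒m<1+n j<t))) (f≤g t ℕ.≤-refl)

  Σ-nonNeg : ∀ t {f : ℕ → ℚ} → (∀ j → j ℕ.< t → 0ℚ ≤ f j) → 0ℚ ≤ Σ t f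
  Σ-nonNeg t {f} 0≤f = subst (_≤ Σ t f) (Σ-0 t) (Σ-mono-≤ t 0≤f)

  Σ-≤-extend : ∀ (f : ℕ → ℚ) → (∀ j → 0ℚ ≤ f j) → ∀ {t u} → t ℕ.≤ u → Σ t f ≤ Σ u f
  Σ-≤-extend f 0≤f {u = zero}  ℕ.z≤n = ≤-refl
  Σ-≤-extend f 0≤f {u = suc u} t≤1+u with ℕ.m≤n⇒m<n∨m≡n t≤1+u
  ... | inj₂ refl       = ≤-refl
  ... | inj₁ (ℕ.s≤s t≤u) = ≤-trans (Σ-≤-extend f 0≤f t≤u) (p≤p+q (Σ u f) (0≤f u))

  Σ-unfoldˡ : ∀ t (f : ℕ → ℚ) → Σ (suc t) f ≡ f 0 + Σ t (λ j → f (suc j))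
  Σ-unfoldˡ zero    f = trans (+-identityˡ (f 0)) (sym (+-identityʳ (f 0)))
  Σ-unfoldˡ (suc t) f = trans (cong (_+ f (suc t)) (Σ-unfoldˡ t f)) (+-assoc (f 0) _ _)

  Σ-single : ∀ t (f : ℕ → ℚ) k → k ℕ.< t → (∀ j → j ℕ.< t → j ≢ k → f j ≡ 0ℚ) → Σ t f ≡ f k
  Σ-single (suc t) f k k<1+t f≡0 with k ℕ.≟ t
  ... | yes refl = trans (cong (_+ f k) rest≡0) (+-identityˡ (f k))
    where
    rest≡0 : Σ t f ≡ 0ℚ
    rest≡0 = trans (Σ-cong t (λ j j<t → f≡0 j (ℕ.m<n⇒m<1+n j<t) (ℕ.<⇒≢ j<t))) (Σ-0 t)
  ... | no k≢t = trans (cong₂ _+_ rest (f≡0 t ℕ.≤-refl (≢-sym k≢t))) (+-identityʳ (f k))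
    where
    rest : Σ t f ≡ f k
    rest = Σ-single t f k (ℕ.≤∧≢⇒< (ℕ.s≤s⁻¹ k<1+t) k≢t) (λ j j<t → f≡0 j (ℕ.m<n⇒m<1+n j<t))

  Σ-telescope : ∀ t (f : ℕ → ℚ) → Σ t (λ j → f (suc j) - f j) ≡ f t - f 0
  Σ-telescope zero    f = sym (+-inverseʳ (f 0))
  Σ-telescope (suc t) f = trans (cong (_+ (f (suc t) - f t)) (Σ-telescope t f))
    (solve 3 (λ a b c → (b :- a) :+ (c :- b) := c :- a) refl (f 0) (f t) (f (suc t)))

  Σ-weighted-square : ∀ t (w f : ℕ → ℚ) a →
    Σ t (λ j → w j * ((f j - a) * (f j - a))) ≡
    Σ t (λ j → w j * (f j * f j)) - (a + a) * Σ t (λ j → w j * f j) + (a * a) * Σ t w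
  Σ-weighted-square zero    w f a = solve 1 (λ a → con 0ℚ := con 0ℚ :- (a :+ a) :* con 0ℚ :+ (a :* a) :* con 0ℚ) refl a
  Σ-weighted-square (suc t) w f a = trans (cong (_+ w t * ((f t - a) * (f t - a))) (Σ-weighted-square t w f a))
    (solve 6 (λ S₂ S₁ S₀ a W F → (S₂ :- (a :+ a) :* S₁ :+ (a :* a) :* S₀) :+ W :* ((F :- a) :* (F :- a))
                              := (S₂ :+ W :* (F :* F)) :- (a :+ a) :* (S₁ :+ W :* F) :+ (a :* a) :* (S₀ :+ W))
       refl (Σ t (λ j → w j * (f j * f j))) (Σ t (λ j → w j * f j)) (Σ t w) a (w t) (f t))

  Σ-square : ∀ t (f : ℕ → ℚ) a →
    Σ t (λ j → (f j - a) * (f j - a)) ≡ Σ t (λ j → f j * f j) - (a + a) * Σ t f + toℚ t * (a * a)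
  Σ-square zero    f a = solve 1 (λ a → con 0ℚ := con 0ℚ :- (a :+ a) :* con 0ℚ :+ con 0ℚ :* (a :* a)) refl a
  Σ-square (suc t) f a = begin
    Σ t (λ j → (f j - a) * (f j - a)) + (F - a) * (F - a)
      ≡⟨ cong (_+ (F - a) * (F - a)) (Σ-square t f a) ⟩
    (Σ t (λ j → f j * f j) - (a + a) * Σ t f + toℚ t * (a * a)) + (F - a) * (F - a)
      ≡⟨ solve 5 (λ S₂ S₁ T a F → (S₂ :- (a :+ a) :* S₁ :+ T :* (a :* a)) :+ (F :- a) :* (F :- a)
                               := (S₂ :+ F :* F) :- (a :+ a) :* (S₁ :+ F) :+ (con 1ℚ :+ T) :* (a :* a))
           refl (Σ t (λ j → f j * f j)) (Σ t f) (toℚ t) a F ⟩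
    Σ (suc t) (λ j → f j * f j) - (a + a) * Σ (suc t) f + (1ℚ + toℚ t) * (a * a)
      ≡⟨ cong (λ z → Σ (suc t) (λ j → f j * f j) - (a + a) * Σ (suc t) f + z * (a * a)) (sym (toℚ-homo-+ 1 t)) ⟩
    Σ (suc t) (λ j → f j * f j) - (a + a) * Σ (suc t) f + toℚ (suc t) * (a * a) ∎
    where
    open ≡-Reasoning
    F = f t

  Σ-Cauchy-Schwarz : ∀ t (f : ℕ → ℚ) → Σ t f * Σ t f ≤ toℚ t * Σ t (λ j → f j * f j)
  Σ-Cauchy-Schwarz zero    f = ≤-refl
  Σ-Cauchy-Schwarz (suc t) f = 0≤q-p⇒p≤q _ _ (subst (0ℚ ≤_) split
    (+-nonNeg _ _ (p≤q⇒0≤q-p _ _ (Σ-Cauchy-Schwarz t f)) (Σ-nonNeg t (λ j _ → square-nonNeg (f j - d)))))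
    where
    open ≡-Reasoning
    A = Σ t f
    S = Σ t (λ j → f j * f j)
    d = f t
    T = toℚ t
    split : (T * S - A * A) + Σ t (λ j → (f j - d) * (f j - d)) ≡ toℚ (suc t) * (S + d * d) - (A + d) * (A + d)
    split = begin
      (T * S - A * A) + Σ t (λ j → (f j - d) * (f j - d))
        ≡⟨ cong ((T * S - A * A) +_) (Σ-square t f d) ⟩
      (T * S - A * A) + (S - (d + d) * A + T * (d * d))
        ≡⟨ solve 4 (λ T S A d → (T :* S :- A :* A) :+ (S :- (d :+ d) :* A :+ T :* (d :* d))
                             := (con 1ℚ :+ T) :* (S :+ d :* d) :- (A :+ d) :* (A :+ d)) refl T S A d ⟩
      (1ℚ + T) * (S + d * d) - (A + d) * (A + d)
        ≡⟨ cong (λ z → z * (S + d * d) - (A + d) * (A + d)) (sym (toℚ-homo-+ 1 t)) ⟩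
      toℚ (suc t) * (S + d * d) - (A + d) * (A + d) ∎

  Σ-split : ∀ k n (f : ℕ → ℚ) → Σ (k ℕ.+ n) f ≡ Σ k f + Σ n (λ t → f (k ℕ.+ t))
  Σ-split k zero    f = trans (cong (λ z → Σ z f) (ℕ.+-identityʳ k)) (sym (+-identityʳ (Σ k f)))
  Σ-split k (suc n) f = begin
    Σ (k ℕ.+ suc n) f                                   ≡⟨ cong (λ z → Σ z f) (ℕ.+-suc k n) ⟩
    Σ (k ℕ.+ n) f + f (k ℕ.+ n)                         ≡⟨ cong (_+ f (k ℕ.+ n)) (Σ-split k n f) ⟩
    Σ k f + Σ n (λ t → f (k ℕ.+ t)) + f (k ℕ.+ n)       ≡⟨ +-assoc (Σ k f) _ _ ⟩
    Σ k f + Σ (suc n) (λ t → f (k ℕ.+ t))               ∎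
    where open ≡-Reasoning

  Σ-harmonic : ∀ n t → Σ t (λ j → 1/ℕ (suc (n ℕ.+ j))) ≡ H (n ℕ.+ t) - H n
  Σ-harmonic n zero    = sym (trans (cong (λ z → H z - H n) (ℕ.+-identityʳ n)) (+-inverseʳ (H n)))
  Σ-harmonic n (suc t) = begin
    Σ t (λ j → 1/ℕ (suc (n ℕ.+ j))) + 1/ℕ (suc (n ℕ.+ t))  ≡⟨ cong (_+ 1/ℕ (suc (n ℕ.+ t))) (Σ-harmonic n t) ⟩
    (H (n ℕ.+ t) - H n) + 1/ℕ (suc (n ℕ.+ t))              ≡⟨ solve 3 (λ a b c → (a :- b) :+ c := (a :+ c) :- b) refl (H (n ℕ.+ t)) (H n) (1/ℕ (suc (n ℕ.+ t))) ⟩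
    H (suc (n ℕ.+ t)) - H n                                 ≡⟨ cong (λ z → H z - H n) (sym (ℕ.+-suc n t)) ⟩
    H (n ℕ.+ suc t) - H n                                   ∎
    where open ≡-Reasoning

  Σ-reciprocal-telescope : ∀ n t →
    Σ t (λ j → 1/ℕ (suc (n ℕ.+ j)) * 1/ℕ (suc (suc (n ℕ.+ j)))) ≡ 1/ℕ (suc n) - 1/ℕ (suc (n ℕ.+ t))
  Σ-reciprocal-telescope n t = begin
    Σ t (λ j → 1/ℕ (suc (n ℕ.+ j)) * 1/ℕ (suc (suc (n ℕ.+ j))))
      ≡⟨ Σ-cong t (λ j _ → trans (sym (1/ℕ-suc-sub (n ℕ.+ j)))
           (trans (cong (λ z → f j - 1/ℕ (suc z)) (sym (ℕ.+-suc n j)))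
                  (solve 2 (λ a b → a :- b := :- (b :- a)) refl (f j) (f (suc j))))) ⟩
    Σ t (λ j → - (f (suc j) - f j))  ≡⟨ Σ-neg t (λ j → f (suc j) - f j) ⟩
    - Σ t (λ j → f (suc j) - f j)     ≡⟨ cong -_ (Σ-telescope t f) ⟩
    - (f t - f 0)                     ≡⟨ solve 2 (λ a b → :- (b :- a) := a :- b) refl (f 0) (f t) ⟩
    f 0 - f t                         ≡⟨ cong (_- f t) (cong (λ z → 1/ℕ (suc z)) (ℕ.+-identityʳ n)) ⟩
    1/ℕ (suc n) - f t                 ∎
    where
    open ≡-Reasoning
    f : ℕ → ℚ
    f j = 1/ℕ (suc (n ℕ.+ j))

module Limits where

  open RationalFacts
  open FiniteSums
  open import Data.Nat as ℕ using (ℕ; zero; suc)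
  import Data.Nat.Properties as ℕ
  open import Data.Rational
  open import Data.Rational.Properties
  open import Relation.Binary.PropositionalEquality
  open import Data.Product using (_,_; proj₁; proj₂; ∃-syntax)
  open import Data.Rational.Solver using (module +-*-Solver)
  open +-*-Solver

  Eventually : (ℕ → Set) → Set
  Eventually P = ∃[ N ] (∀ m → N ℕ.≤ m → P m)

  TendsToZero : (ℕ → ℚ) → Set
  TendsToZero a = ∀ ε → 0ℚ < ε → Eventually (λ m → a m < ε)

  harmonicTail : ℕ → ℕ → ℚ
  harmonicTail M k = Σ k (λ t → 1/ℕ (suc (t ℕ.+ M)))

  harmonicTail-nonNeg : ∀ M k → 0ℚ ≤ harmonicTail M k
  harmonicTail-nonNeg M k = Σ-nonNeg k (λ t _ → 1/ℕ-nonNeg (t ℕ.+ M))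

  harmonicTail-mono-≤ : ∀ M {k l} → k ℕ.≤ l → harmonicTail M k ≤ harmonicTail M l
  harmonicTail-mono-≤ M = Σ-≤-extend (λ t → 1/ℕ (suc (t ℕ.+ M))) (λ t → 1/ℕ-nonNeg (t ℕ.+ M))

  -- The n = M + k + 1 terms following index k are each at least 1 / 2n.
  harmonicTail-doubling : ∀ M k → harmonicTail M k + 1/ℕ 2 ≤ harmonicTail M (k ℕ.+ suc (M ℕ.+ k))
  harmonicTail-doubling M k = begin
    T k + 1/ℕ 2                                        ≡⟨ cong (T k +_) (sym (trans (Σ-const n q) n*q≡½)) ⟩
    T k + Σ n (λ _ → q)                                ≤⟨ +-monoʳ-≤ (T k) (Σ-mono-≤ n q≤term) ⟩
    T k + Σ n (λ t → 1/ℕ (suc (k ℕ.+ t ℕ.+ M)))        ≡⟨ sym (Σ-split k n (λ t → 1/ℕ (suc (t ℕ.+ M)))) ⟩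
    T (k ℕ.+ n)                                        ∎
    where
    open ≤-Reasoning
    T = harmonicTail M
    n = suc (M ℕ.+ k)
    q = 1/ℕ (2 ℕ.* n)
    n*q≡½ : toℚ n * q ≡ 1/ℕ 2
    n*q≡½ = begin-equality
      toℚ n * q                   ≡⟨ cong (toℚ n *_) (1/ℕ-homo-* 1 (M ℕ.+ k)) ⟩
      toℚ n * (1/ℕ 2 * 1/ℕ n)     ≡⟨ solve 3 (λ x h y → x :* (h :* y) := h :* (x :* y)) refl (toℚ n) (1/ℕ 2) (1/ℕ n) ⟩
      1/ℕ 2 * (toℚ n * 1/ℕ n)     ≡⟨ cong (1/ℕ 2 *_) (toℚ*1/ℕ≡1 n) ⟩
      1/ℕ 2 * 1ℚ                  ≡⟨ *-identityʳ (1/ℕ 2) ⟩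
      1/ℕ 2                       ∎
    q≤term : ∀ t → t ℕ.< n → q ≤ 1/ℕ (suc (k ℕ.+ t ℕ.+ M))
    q≤term t t<n = 1/ℕ-antimono-≤ {k ℕ.+ t ℕ.+ M} {ℕ.pred (2 ℕ.* n)} (ℕ.≤-trans
      (ℕ.≤-reflexive (trans (ℕ.+-comm (k ℕ.+ t) M) (sym (ℕ.+-assoc M k t))))
      (ℕ.+-monoʳ-≤ (M ℕ.+ k) (ℕ.≤-trans (ℕ.<⇒≤ t<n) (ℕ.m≤m+n n 0))))

  harmonicTail-unbounded : ∀ M s → ∃[ K ] toℚ s * 1/ℕ 2 ≤ harmonicTail M K
  harmonicTail-unbounded M zero    = 0 , ≤-refl
  harmonicTail-unbounded M (suc s) with harmonicTail-unbounded M s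
  ... | K , s/2≤T = K ℕ.+ suc (M ℕ.+ K) , (begin
    toℚ (suc s) * 1/ℕ 2            ≡⟨ cong (_* 1/ℕ 2) (toℚ-homo-+ 1 s) ⟩
    (1ℚ + toℚ s) * 1/ℕ 2           ≡⟨ solve 2 (λ x h → (con 1ℚ :+ x) :* h := x :* h :+ h) refl (toℚ s) (1/ℕ 2) ⟩
    toℚ s * 1/ℕ 2 + 1/ℕ 2          ≤⟨ +-monoˡ-≤ (1/ℕ 2) s/2≤T ⟩
    harmonicTail M K + 1/ℕ 2       ≤⟨ harmonicTail-doubling M K ⟩
    harmonicTail M (K ℕ.+ suc (M ℕ.+ K)) ∎)
    where open ≤-Reasoning

  module _ (D : ℕ → ℚ) (M : ℕ) (α : ℚ) (0≤D : ∀ m → M ℕ.≤ m → 0ℚ ≤ D m)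
           (D-decay : ∀ m → M ℕ.≤ m → D (suc m) ≤ D m - α * 1/ℕ (suc m) * D m) where

    -- (1 − α b) (1 + α (T + b)) ≤ 1 + α T, so the decay factors multiply to at most 1 / (1 + α T).
    decay-bound : 0ℚ ≤ α → ∀ k → D (k ℕ.+ M) * (1ℚ + α * harmonicTail M k) ≤ D M
    decay-bound 0≤α zero    = ≤-reflexive (solve 2 (λ D a → D :* (con 1ℚ :+ a :* con 0ℚ) := D) refl (D M) α)
    decay-bound 0≤α (suc k) = begin
      D (suc m) * (1ℚ + α * (T + b))             ≤⟨ *-monoʳ-≤-0≤ _ 0≤factor (D-decay m (ℕ.m≤n+m M k)) ⟩
      (D m - α * b * D m) * (1ℚ + α * (T + b))   ≤⟨ 0≤q-p⇒p≤q _ _ (subst (0ℚ ≤_) gap 0≤gap) ⟩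
      D m * (1ℚ + α * T)                         ≤⟨ decay-bound 0≤α k ⟩
      D M                                        ∎
      where
      open ≤-Reasoning
      m = k ℕ.+ M
      b = 1/ℕ (suc m)
      T = harmonicTail M k
      0≤αb : 0ℚ ≤ α * b
      0≤αb = *-nonNeg α b 0≤α (1/ℕ-nonNeg m)
      0≤factor : 0ℚ ≤ 1ℚ + α * (T + b)
      0≤factor = +-nonNeg 1ℚ _ (<⇒≤ (toℚ-pos 0)) (*-nonNeg α _ 0≤α (+-nonNeg T b (harmonicTail-nonNeg M k) (1/ℕ-nonNeg m)))
      0≤gap : 0ℚ ≤ D m * ((α * b) * (α * T + α * b))
      0≤gap = *-nonNeg (D m) _ (0≤D m (ℕ.m≤n+m M k))
                (*-nonNeg (α * b) _ 0≤αb (+-nonNeg _ _ (*-nonNeg α T 0≤α (harmonicTail-nonNeg M k)) 0≤αb))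
      gap : D m * ((α * b) * (α * T + α * b)) ≡ D m * (1ℚ + α * T) - (D m - α * b * D m) * (1ℚ + α * (T + b))
      gap = solve 4 (λ D a b t → D :* ((a :* b) :* (a :* t :+ a :* b))
                              := D :* (con 1ℚ :+ a :* t) :- (D :- a :* b :* D) :* (con 1ℚ :+ a :* (t :+ b)))
              refl (D m) α b T

    -- The harmonic tail is unbounded, so the factor 1 + α T k eventually beats D M / ε.
    decay⇒tendsToZero : 0ℚ < α → TendsToZero D
    decay⇒tendsToZero 0<α ε 0<ε = K ℕ.+ M , D<ε
      where
      q = ε * (α * 1/ℕ 2)
      0<q : 0ℚ < q
      0<q = *-pos ε _ 0<ε (*-pos α (1/ℕ 2) 0<α (1/ℕ-pos 1))
      instance
        q≢0 : NonZero q
        q≢0 = >-nonZero 0<q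
      s = proj₁ (archimedean (D M * 1/ q))
      K = proj₁ (harmonicTail-unbounded M s)
      DM<sq : D M < toℚ s * q
      DM<sq = subst (_< toℚ s * q) (trans (*-assoc (D M) (1/ q) q) (trans (cong (D M *_) (*-inverseˡ q)) (*-identityʳ (D M))))
                (*-monoˡ-<-pos q {{positive 0<q}} (proj₂ (archimedean (D M * 1/ q))))
      D<ε : ∀ m → K ℕ.+ M ℕ.≤ m → D m < ε
      D<ε m K+M≤m = *-cancelʳ-<-nonNeg P {{nonNegative 0≤P}} (subst (λ z → D z * P < ε * P) (ℕ.m∸n+n≡m M≤m) DP<εP)
        where
        M≤m = ℕ.≤-trans (ℕ.m≤n+m M K) K+M≤m
        k = m ℕ.∸ M
        K≤k : K ℕ.≤ k
        K≤k = subst (ℕ._≤ k) (ℕ.m+n∸n≡m K M) (ℕ.∸-monoˡ-≤ M K+M≤m)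
        T = harmonicTail M k
        P = 1ℚ + α * T
        0≤P : 0ℚ ≤ P
        0≤P = +-nonNeg 1ℚ _ (<⇒≤ (toℚ-pos 0)) (*-nonNeg α T (<⇒≤ 0<α) (harmonicTail-nonNeg M k))
        DP<εP : D (k ℕ.+ M) * P < ε * P
        DP<εP = begin-strict
          D (k ℕ.+ M) * P          ≤⟨ decay-bound (<⇒≤ 0<α) k ⟩
          D M                      <⟨ DM<sq ⟩
          toℚ s * q                ≡⟨ solve 4 (λ s e a h → s :* (e :* (a :* h)) := e :* (a :* (s :* h))) refl (toℚ s) ε α (1/ℕ 2) ⟩
          ε * (α * (toℚ s * 1/ℕ 2)) ≤⟨ *-monoˡ-≤-0≤ ε (<⇒≤ 0<ε) (*-monoˡ-≤-0≤ α (<⇒≤ 0<α)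
                                        (≤-trans (proj₂ (harmonicTail-unbounded M s)) (harmonicTail-mono-≤ M K≤k))) ⟩
          ε * (α * T)              ≤⟨ *-monoˡ-≤-0≤ ε (<⇒≤ 0<ε) (subst (_≤ P) (+-identityˡ (α * T)) (+-monoˡ-≤ (α * T) (<⇒≤ (toℚ-pos 0)))) ⟩
          ε * P                    ∎
          where open ≤-Reasoning

  -- Within y / 2 of y, g ≥ y / 2, so (f − L)² y² / 4 ≤ ((f − L) g)² = L² (g − y)².
  quotient-close : ∀ f g L y ε → 0ℚ < y → 0ℚ < ε →
    (g - y) * (g - y) < y * y * 1/ℕ 4 →
    L * L * ((g - y) * (g - y)) < ε * ε * (y * y * 1/ℕ 4) →
    (0ℚ < g → f * g ≡ L * y) →
    ∣ f - L ∣ < ε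
  quotient-close f g L y ε 0<y 0<ε near close fg≡Ly =
    ∣p∣<q-of-squares (f - L) ε 0<ε (*-cancelʳ-<-nonNeg β {{nonNegative 0≤β}} (begin-strict
      d * d * β                                 ≤⟨ *-monoˡ-≤-0≤ (d * d) (square-nonNeg d) β≤g² ⟩
      d * d * (g * g)                           ≡⟨ solve 2 (λ d g → d :* d :* (g :* g) := (d :* g) :* (d :* g)) refl d g ⟩
      (d * g) * (d * g)                         ≡⟨ cong (λ z → z * z) dg≡ ⟩
      (L * (y - g)) * (L * (y - g))             ≡⟨ solve 3 (λ L y g → (L :* (y :- g)) :* (L :* (y :- g)) := L :* L :* ((g :- y) :* (g :- y))) refl L y g ⟩
      L * L * ((g - y) * (g - y))               <⟨ close ⟩
      ε * ε * β                                 ∎))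
    where
    open ≤-Reasoning
    β = y * y * 1/ℕ 4
    h = y * 1/ℕ 2
    d = f - L
    0≤h : 0ℚ ≤ h
    0≤h = *-nonNeg y (1/ℕ 2) (<⇒≤ 0<y) (1/ℕ-nonNeg 1)
    h≤g : h ≤ g
    h≤g = half≤-of-near g y 0<y near
    h²≡β : h * h ≡ β
    h²≡β = trans (solve 2 (λ y t → (y :* t) :* (y :* t) := y :* y :* (t :* t)) refl y (1/ℕ 2)) (cong (y * y *_) ½*½≡¼)
    0≤β : 0ℚ ≤ β
    0≤β = subst (0ℚ ≤_) h²≡β (square-nonNeg h)
    β≤g² : β ≤ g * g
    β≤g² = subst (_≤ g * g) h²≡β (*-mono-≤-0≤ 0≤h 0≤h h≤g h≤g)
    dg≡ : d * g ≡ L * (y - g)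
    dg≡ = begin-equality
      (f - L) * g        ≡⟨ solve 3 (λ f L g → (f :- L) :* g := f :* g :- L :* g) refl f L g ⟩
      f * g - L * g      ≡⟨ cong (_- L * g) (fg≡Ly (<-≤-trans (*-pos y (1/ℕ 2) 0<y (1/ℕ-pos 1)) h≤g)) ⟩
      L * y - L * g      ≡⟨ solve 3 (λ L y g → L :* y :- L :* g := L :* (y :- g)) refl L y g ⟩
      L * (y - g)        ∎

  quotient-converges : ∀ (f g : ℕ → ℚ) (L y : ℚ) → 0ℚ < y →
    TendsToZero (λ m → (g m - y) * (g m - y)) →
    Eventually (λ m → 0ℚ < g m → f m * g m ≡ L * y) →
    ConvergesTo f L
  quotient-converges f g L y 0<y g→y (N₀ , fg≡Ly) ε 0<ε = N₀ ℕ.+ (N₁ ℕ.+ N₂) , λ m N≤m →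
    quotient-close (f m) (g m) L y ε 0<y 0<ε
      (proj₂ near m (ℕ.≤-trans (ℕ.m≤m+n N₁ N₂) (N₁+N₂≤ N≤m)))
      (scaled-close m (ℕ.≤-trans (ℕ.m≤n+m N₂ N₁) (N₁+N₂≤ N≤m)))
      (fg≡Ly m (ℕ.≤-trans (ℕ.m≤m+n N₀ (N₁ ℕ.+ N₂)) N≤m))
    where
    β = y * y * 1/ℕ 4
    0<β : 0ℚ < β
    0<β = *-pos _ _ (*-pos y y 0<y 0<y) (1/ℕ-pos 3)
    0<ε²β : 0ℚ < ε * ε * β
    0<ε²β = *-pos _ β (*-pos ε ε 0<ε 0<ε) 0<β
    L²<L²+1 : L * L < L * L + 1ℚ
    L²<L²+1 = subst (_< L * L + 1ℚ) (+-identityʳ (L * L)) (+-monoʳ-< (L * L) (toℚ-pos 0))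
    0<L²+1 : 0ℚ < L * L + 1ℚ
    0<L²+1 = ≤-<-trans (square-nonNeg L) L²<L²+1
    instance
      L²+1≢0 : NonZero (L * L + 1ℚ)
      L²+1≢0 = >-nonZero 0<L²+1
    κ = 1/ (L * L + 1ℚ)
    0<κ : 0ℚ < κ
    0<κ = 1/-pos (L * L + 1ℚ) 0<L²+1
    near = g→y β 0<β
    closer = g→y (ε * ε * β * κ) (*-pos _ κ 0<ε²β 0<κ)
    N₁ = proj₁ near
    N₂ = proj₁ closer
    N₁+N₂≤ : ∀ {m} → N₀ ℕ.+ (N₁ ℕ.+ N₂) ℕ.≤ m → N₁ ℕ.+ N₂ ℕ.≤ m
    N₁+N₂≤ = ℕ.≤-trans (ℕ.m≤n+m (N₁ ℕ.+ N₂) N₀)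
    scaled-close : ∀ m → N₂ ℕ.≤ m → L * L * ((g m - y) * (g m - y)) < ε * ε * β
    scaled-close m N₂≤m = begin-strict
      L * L * ((g m - y) * (g m - y))  ≤⟨ *-monoˡ-≤-0≤ (L * L) (square-nonNeg L) (<⇒≤ (proj₂ closer m N₂≤m)) ⟩
      L * L * (ε * ε * β * κ)          ≡⟨ solve 4 (λ L e b k → L :* L :* (e :* e :* b :* k) := (e :* e :* b) :* (L :* L :* k)) refl L ε β κ ⟩
      (ε * ε * β) * (L * L * κ)        <⟨ *-monoʳ-<-pos (ε * ε * β) {{positive 0<ε²β}} L²κ<1 ⟩
      (ε * ε * β) * 1ℚ                 ≡⟨ *-identityʳ _ ⟩
      ε * ε * β                        ∎
      where
      open ≤-Reasoning
      L²κ<1 : L * L * κ < 1ℚ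
      L²κ<1 = subst (L * L * κ <_) (*-inverseʳ (L * L + 1ℚ)) (*-monoˡ-<-pos κ {{positive 0<κ}} L²<L²+1)

module Expectation where

  open RationalFacts
  open import Data.Nat as ℕ using (ℕ; suc)
  open import Data.Rational
  open import Data.Rational.Properties
  open import Relation.Binary.PropositionalEquality
  open import Data.Product using (_×_; _,_)
  open import Data.List using (List; []; _∷_; _++_; map; concatMap; length)
  open import Data.List.Relation.Unary.All using (All; []; _∷_)
  open import Data.Nat.ListAction using (sum)
  open import Data.Rational.Solver using (module +-*-Solver)
  open +-*-Solver

  blockSum : (ℕ → ℚ) → Config → ℚ
  blockSum g []      = 0ℚ
  blockSum g (ℓ ∷ s) = g ℓ + blockSum g s

  expect : (ℕ → ℚ) → Dist → ℚ
  expect g []            = 0ℚ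
  expect g ((p , s) ∷ d) = p * blockSum g s + expect g d

  blockSum-++ : ∀ g s t → blockSum g (s ++ t) ≡ blockSum g s + blockSum g t
  blockSum-++ g []      t = sym (+-identityˡ _)
  blockSum-++ g (ℓ ∷ s) t = trans (cong (g ℓ +_) (blockSum-++ g s t)) (sym (+-assoc (g ℓ) _ _))

  blockSum-cong : ∀ {f g} s → (∀ ℓ → f ℓ ≡ g ℓ) → blockSum f s ≡ blockSum g s
  blockSum-cong []      f≡g = refl
  blockSum-cong (ℓ ∷ s) f≡g = cong₂ _+_ (f≡g ℓ) (blockSum-cong s f≡g)

  blockSum-*ˡ : ∀ c f s → blockSum (λ ℓ → c * f ℓ) s ≡ c * blockSum f s
  blockSum-*ˡ c f []      = sym (*-zeroʳ c)
  blockSum-*ˡ c f (ℓ ∷ s) = trans (cong (c * f ℓ +_) (blockSum-*ˡ c f s)) (sym (*-distribˡ-+ c (f ℓ) _))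

  blockSum-toℚ : ∀ s → blockSum toℚ s ≡ toℚ (sum s)
  blockSum-toℚ []      = refl
  blockSum-toℚ (ℓ ∷ s) = trans (cong (toℚ ℓ +_) (blockSum-toℚ s)) (sym (toℚ-homo-+ ℓ (sum s)))

  blockSum-1 : ∀ s → blockSum (λ _ → 1ℚ) s ≡ toℚ (length s)
  blockSum-1 []      = refl
  blockSum-1 (ℓ ∷ s) = trans (cong (1ℚ +_) (blockSum-1 s)) (sym (toℚ-homo-+ 1 (length s)))

  expect-++ : ∀ g d e → expect g (d ++ e) ≡ expect g d + expect g e
  expect-++ g []            e = sym (+-identityˡ _)
  expect-++ g ((p , s) ∷ d) e = trans (cong (p * blockSum g s +_) (expect-++ g d e)) (sym (+-assoc (p * blockSum g s) _ _))

  -- expBlocks counts blocks with a local fold; any fold with the same equations is expect (λ _ → 1ℚ).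
  private
    blockCount-unique : {G : Dist → ℚ} → G [] ≡ 0ℚ → (∀ p s d → G ((p , s) ∷ d) ≡ p * toℚ (length s) + G d) →
                        ∀ d → G d ≡ expect (λ _ → 1ℚ) d
    blockCount-unique G[] G∷ []            = G[]
    blockCount-unique {G} G[] G∷ ((p , s) ∷ d) =
      trans (G∷ p s d) (cong₂ (λ x y → p * x + y) (sym (blockSum-1 s)) (blockCount-unique {G} G[] G∷ d))

  expBlocks≡expect : ∀ B r m → expBlocks B r m ≡ expect (λ _ → 1ℚ) (dist B r m)
  expBlocks≡expect B r m with dist B r m | blockCount-unique refl (λ _ _ _ → refl)
  ... | d | G≡expect = G≡expect d

  outcomeExpect : (ℕ → ℚ) → (ℕ → ℚ) → List (ℕ × Config) → ℚ
  outcomeExpect c g []               = 0ℚ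
  outcomeExpect c g ((ℓ , s) ∷ os) = c ℓ * blockSum g s + outcomeExpect c g os

  outcomeWeight : (ℕ → ℚ) → List (ℕ × Config) → ℚ
  outcomeWeight c []              = 0ℚ
  outcomeWeight c ((ℓ , _) ∷ os) = c ℓ + outcomeWeight c os

  expect-map : ∀ {φ : ℕ × Config → ℚ × Config} g c → (∀ ℓ s → φ (ℓ , s) ≡ (c ℓ , s)) →
               ∀ os → expect g (map φ os) ≡ outcomeExpect c g os
  expect-map g c φ≡ []             = refl
  expect-map g c φ≡ ((ℓ , s) ∷ os) rewrite φ≡ ℓ s = cong (c ℓ * blockSum g s +_) (expect-map g c φ≡ os)

  outcomeExpect-cong : ∀ {c c′} g os → (∀ ℓ → c ℓ ≡ c′ ℓ) → outcomeExpect c g os ≡ outcomeExpect c′ g os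
  outcomeExpect-cong g []             c≡c′ = refl
  outcomeExpect-cong g ((ℓ , s) ∷ os) c≡c′ = cong₂ _+_ (cong (_* blockSum g s) (c≡c′ ℓ)) (outcomeExpect-cong g os c≡c′)

  outcomeExpect-map-∷ : ∀ {ψ : ℕ × Config → ℕ × Config} c g ℓ₀ → (∀ ℓ s → ψ (ℓ , s) ≡ (ℓ , ℓ₀ ∷ s)) →
    ∀ os → outcomeExpect c g (map ψ os) ≡ outcomeExpect c g os + g ℓ₀ * outcomeWeight c os
  outcomeExpect-map-∷ c g ℓ₀ ψ≡ [] = sym (trans (+-identityˡ _) (*-zeroʳ (g ℓ₀)))
  outcomeExpect-map-∷ c g ℓ₀ ψ≡ ((ℓ , s) ∷ os) rewrite ψ≡ ℓ s =
    trans (cong (c ℓ * (g ℓ₀ + blockSum g s) +_) (outcomeExpect-map-∷ c g ℓ₀ ψ≡ os))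
          (solve 5 (λ a x b E W → a :* (x :+ b) :+ (E :+ x :* W) := (a :* b :+ E) :+ x :* (a :+ W))
             refl (c ℓ) (g ℓ₀) (blockSum g s) (outcomeExpect c g os) (outcomeWeight c os))

  outcomeWeight-map-∷ : ∀ {ψ : ℕ × Config → ℕ × Config} c ℓ₀ → (∀ ℓ s → ψ (ℓ , s) ≡ (ℓ , ℓ₀ ∷ s)) →
    ∀ os → outcomeWeight c (map ψ os) ≡ outcomeWeight c os
  outcomeWeight-map-∷ c ℓ₀ ψ≡ []             = refl
  outcomeWeight-map-∷ c ℓ₀ ψ≡ ((ℓ , s) ∷ os) rewrite ψ≡ ℓ s = cong (c ℓ +_) (outcomeWeight-map-∷ c ℓ₀ ψ≡ os)

  drift : (B r : ℕ) → (ℕ → ℚ) → ℕ → ℚ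
  drift B r g ℓ = toℚ ℓ * (blockSum g (newBlocks B r ℓ) - g ℓ)

  module _ (B r : ℕ) where

    outcomeWeight-outcomes : ∀ c s → outcomeWeight c (outcomes B r s) ≡ blockSum c s
    outcomeWeight-outcomes c []      = refl
    outcomeWeight-outcomes c (ℓ ∷ s) =
      cong (c ℓ +_) (trans (outcomeWeight-map-∷ c ℓ (λ _ _ → refl) (outcomes B r s)) (outcomeWeight-outcomes c s))

    outcomeExpect-outcomes : ∀ c g s → outcomeExpect c g (outcomes B r s) ≡
      blockSum c s * blockSum g s + blockSum (λ ℓ → c ℓ * (blockSum g (newBlocks B r ℓ) - g ℓ)) s
    outcomeExpect-outcomes c g []      = sym (trans (+-identityʳ _) (*-zeroˡ 0ℚ))
    outcomeExpect-outcomes c g (ℓ ∷ s) = begin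
      c ℓ * blockSum g (N ++ s) + outcomeExpect c g (map _ (outcomes B r s))
        ≡⟨ cong₂ (λ x y → c ℓ * x + y) (blockSum-++ g N s) (outcomeExpect-map-∷ c g ℓ (λ _ _ → refl) (outcomes B r s)) ⟩
      c ℓ * (blockSum g N + blockSum g s) + (outcomeExpect c g (outcomes B r s) + g ℓ * outcomeWeight c (outcomes B r s))
        ≡⟨ cong₂ (λ x y → c ℓ * (blockSum g N + blockSum g s) + (x + g ℓ * y))
                 (outcomeExpect-outcomes c g s) (outcomeWeight-outcomes c s) ⟩
      c ℓ * (blockSum g N + blockSum g s) + ((blockSum c s * blockSum g s + R) + g ℓ * blockSum c s)
        ≡⟨ solve 6 (λ a N G C R x → a :* (N :+ G) :+ ((C :* G :+ R) :+ x :* C)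
                                 := (a :+ C) :* (x :+ G) :+ (a :* (N :- x) :+ R))
             refl (c ℓ) (blockSum g N) (blockSum g s) (blockSum c s) R (g ℓ) ⟩
      (c ℓ + blockSum c s) * (g ℓ + blockSum g s) + (c ℓ * (blockSum g N - g ℓ) + R)
        ∎
      where
      open ≡-Reasoning
      N = newBlocks B r ℓ
      R = blockSum (λ ℓ → c ℓ * (blockSum g (newBlocks B r ℓ) - g ℓ)) s

  choiceProb-keys : ∀ s ℓ t → sum s ≡ suc t → choiceProb s ℓ ≡ toℚ ℓ * 1/ℕ (suc t)
  choiceProb-keys s ℓ t sum≡ with sum s | sum≡
  ... | .(suc t) | refl = ÷?-toℚ (toℚ ℓ) (suc t)

  expect-concatMap : ∀ {φ : ℚ × Config → Dist} (P : ℚ × Config → Set) g h c →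
    (∀ p s → P (p , s) → expect g (φ (p , s)) ≡ p * blockSum g s + c * (p * blockSum h s)) →
    ∀ d → All P d → expect g (concatMap φ d) ≡ expect g d + c * expect h d
  expect-concatMap P g h c φ-step [] [] = sym (trans (+-identityˡ (c * 0ℚ)) (*-zeroʳ c))
  expect-concatMap {φ} P g h c φ-step ((p , s) ∷ d) (Pps ∷ Pd) =
    trans (expect-++ g (φ (p , s)) (concatMap φ d))
    (trans (cong₂ _+_ (φ-step p s Pps) (expect-concatMap P g h c φ-step d Pd))
           (solve 5 (λ a b c x y → (a :+ c :* b) :+ (x :+ c :* y) := (a :+ x) :+ c :* (b :+ y))
              refl (p * blockSum g s) (p * blockSum h s) c (expect g d) (expect h d)))

  HasKeys : ℕ → ℚ × Config → Set
  HasKeys n (_ , s) = sum s ≡ n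

  outcomeExpect-choice : ∀ B r t g p s → sum s ≡ suc t →
    outcomeExpect (λ ℓ → p * choiceProb s ℓ) g (outcomes B r s) ≡ p * blockSum g s + 1/ℕ (suc t) * (p * blockSum (drift B r g) s)
  outcomeExpect-choice B r t g p s keys = begin
    outcomeExpect (λ ℓ → p * choiceProb s ℓ) g (outcomes B r s)
      ≡⟨ outcomeExpect-cong g (outcomes B r s) (λ ℓ → trans (cong (p *_) (choiceProb-keys s ℓ t keys))
                                                  (solve 3 (λ p x I → p :* (x :* I) := (p :* I) :* x) refl p (toℚ ℓ) I)) ⟩
    outcomeExpect c g (outcomes B r s)
      ≡⟨ outcomeExpect-outcomes B r c g s ⟩
    blockSum c s * blockSum g s + blockSum (λ ℓ → c ℓ * (blockSum g (newBlocks B r ℓ) - g ℓ)) s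
      ≡⟨ cong₂ (λ x y → x * blockSum g s + y) Σc≡p
           (trans (blockSum-cong s (λ ℓ → *-assoc (p * I) (toℚ ℓ) _)) (blockSum-*ˡ (p * I) (drift B r g) s)) ⟩
    p * blockSum g s + (p * I) * blockSum (drift B r g) s
      ≡⟨ cong (p * blockSum g s +_) (solve 3 (λ p I H → (p :* I) :* H := I :* (p :* H)) refl p I (blockSum (drift B r g) s)) ⟩
    p * blockSum g s + I * (p * blockSum (drift B r g) s)
      ∎
    where
    open ≡-Reasoning
    I = 1/ℕ (suc t)
    c : ℕ → ℚ
    c ℓ = (p * I) * toℚ ℓ
    Σc≡p : blockSum c s ≡ p
    Σc≡p = begin
      blockSum c s                ≡⟨ blockSum-*ˡ (p * I) toℚ s ⟩
      (p * I) * blockSum toℚ s    ≡⟨ cong ((p * I) *_) (trans (blockSum-toℚ s) (cong toℚ keys)) ⟩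
      (p * I) * toℚ (suc t)       ≡⟨ *-assoc p I _ ⟩
      p * (I * toℚ (suc t))       ≡⟨ cong (p *_) (1/ℕ*toℚ≡1 (suc t)) ⟩
      p * 1ℚ                      ≡⟨ *-identityʳ p ⟩
      p                           ∎

  expect-step : ∀ B r t g d → All (HasKeys (suc t)) d →
    expect g (step B r d) ≡ expect g d + 1/ℕ (suc t) * expect (drift B r g) d
  expect-step B r t g = expect-concatMap (HasKeys (suc t)) g (drift B r g) (1/ℕ (suc t))
    (λ p s keys → trans (expect-map g (λ ℓ → p * choiceProb s ℓ) (λ _ _ → refl) (outcomes B r s)) (outcomeExpect-choice B r t g p s keys))

module Cycles where

  open RationalFacts
  open FiniteSums
  open Limits
  open import Data.Nat as ℕ using (ℕ; zero; suc)
  import Data.Nat.Properties as ℕ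
  open import Data.Rational
  open import Data.Rational.Properties
  open import Relation.Binary.PropositionalEquality
  open import Data.Product using (_,_; proj₁; proj₂)
  open import Data.Rational.Solver using (module +-*-Solver)
  open +-*-Solver

  cyclePred : ℕ → ℕ → ℕ
  cyclePred n zero    = n
  cyclePred n (suc j) = j

  cyclePred-< : ∀ n j → j ℕ.< suc n → cyclePred n j ℕ.< suc n
  cyclePred-< n zero    _   = ℕ.≤-refl
  cyclePred-< n (suc j) j<n = ℕ.<-trans (ℕ.n<1+n j) j<n

  Σ-cyclePred : ∀ n (f : ℕ → ℚ) → Σ (suc n) (λ j → f (cyclePred n j)) ≡ Σ (suc n) f
  Σ-cyclePred n f = trans (Σ-unfoldˡ n (λ j → f (cyclePred n j))) (+-comm (f n) (Σ n f))

  Σ-cyclePred-sub : ∀ n (f : ℕ → ℚ) → Σ (suc n) (λ j → f (cyclePred n j) - f j) ≡ 0ℚ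
  Σ-cyclePred-sub n f = begin
    Σ (suc n) (λ j → f (cyclePred n j) - f j)                 ≡⟨ Σ-- (suc n) _ f ⟩
    Σ (suc n) (λ j → f (cyclePred n j)) - Σ (suc n) f          ≡⟨ cong (_- Σ (suc n) f) (Σ-cyclePred n f) ⟩
    Σ (suc n) f - Σ (suc n) f                                  ≡⟨ +-inverseʳ (Σ (suc n) f) ⟩
    0ℚ                                                         ∎
    where open ≡-Reasoning

  -- The weights w j = 1 / (i + j + 1) make the mass Σ w j v m j invariant, and the weighted
  -- variance around its mean 1 / Z is a Lyapunov function.
  module CyclicAveraging (i′ : ℕ) (v : ℕ → ℕ → ℚ) (M : ℕ)
    (v-step : ∀ m → M ℕ.≤ m → ∀ j → j ℕ.< suc i′ →
              v (suc m) j ≡ v m j + toℚ (suc (suc i′ ℕ.+ j)) * 1/ℕ (suc m) * (v m (cyclePred i′ j) - v m j))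
    (v-mass : Σ (suc i′) (λ j → 1/ℕ (suc (suc i′ ℕ.+ j)) * v M j) ≡ 1ℚ) where

    i : ℕ
    i = suc i′

    rate : ℕ → ℚ
    rate j = toℚ (suc (i ℕ.+ j))

    w : ℕ → ℚ
    w j = 1/ℕ (suc (i ℕ.+ j))

    jump : ℕ → ℕ → ℚ
    jump m j = v m (cyclePred i′ j) - v m j

    w-step : ∀ m → M ℕ.≤ m → ∀ j → j ℕ.< i → w j * v (suc m) j ≡ w j * v m j + 1/ℕ (suc m) * jump m j
    w-step m M≤m j j<i rewrite v-step m M≤m j j<i = begin
      w j * (v m j + rate j * b * jump m j)        ≡⟨ solve 5 (λ W C b x d → W :* (x :+ C :* b :* d) := W :* x :+ b :* ((W :* C) :* d))
                                                        refl (w j) (rate j) b (v m j) (jump m j) ⟩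
      w j * v m j + b * ((w j * rate j) * jump m j) ≡⟨ cong (λ z → w j * v m j + b * (z * jump m j)) (1/ℕ*toℚ≡1 (suc (i ℕ.+ j))) ⟩
      w j * v m j + b * (1ℚ * jump m j)             ≡⟨ cong (λ z → w j * v m j + b * z) (*-identityˡ (jump m j)) ⟩
      w j * v m j + b * jump m j                    ∎
      where
      open ≡-Reasoning
      b = 1/ℕ (suc m)

    mass : ∀ m → M ℕ.≤ m → Σ i (λ j → w j * v m j) ≡ 1ℚ
    mass m M≤m = subst (λ z → Σ i (λ j → w j * v z j) ≡ 1ℚ) (ℕ.m∸n+n≡m M≤m) (mass-after (m ℕ.∸ M))
      where
      mass-after : ∀ k → Σ i (λ j → w j * v (k ℕ.+ M) j) ≡ 1ℚ
      mass-after zero    = v-mass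
      mass-after (suc k) = begin
        Σ i (λ j → w j * v (suc m′) j)                   ≡⟨ Σ-cong i (λ j j<i → w-step m′ (ℕ.m≤n+m M k) j j<i) ⟩
        Σ i (λ j → w j * v m′ j + 1/ℕ (suc m′) * jump m′ j) ≡⟨ Σ-+ i _ _ ⟩
        Σ i (λ j → w j * v m′ j) + Σ i (λ j → 1/ℕ (suc m′) * jump m′ j)
          ≡⟨ cong₂ _+_ (mass-after k) (trans (Σ-*ˡ i (1/ℕ (suc m′)) (jump m′))
                                      (trans (cong (1/ℕ (suc m′) *_) (Σ-cyclePred-sub i′ (v m′))) (*-zeroʳ (1/ℕ (suc m′))))) ⟩
        1ℚ + 0ℚ                                          ≡⟨ +-identityʳ 1ℚ ⟩
        1ℚ                                               ∎
        where
        open ≡-Reasoning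
        m′ = k ℕ.+ M

    secondMoment : ℕ → ℚ
    secondMoment m = Σ i (λ j → w j * (v m j * v m j))

    energy : ℕ → ℚ
    energy m = Σ i (λ j → jump m j * jump m j)

    rateEnergy : ℕ → ℚ
    rateEnergy m = Σ i (λ j → rate j * (jump m j * jump m j))

    energy-nonNeg : ∀ m → 0ℚ ≤ energy m
    energy-nonNeg m = Σ-nonNeg i (λ j _ → square-nonNeg (jump m j))

    rateEnergy≤ : ∀ m → rateEnergy m ≤ toℚ (i ℕ.+ i) * energy m
    rateEnergy≤ m = ≤-trans
      (Σ-mono-≤ i (λ j j<i → *-monoʳ-≤-0≤ _ (square-nonNeg (jump m j)) (toℚ-mono-≤ (ℕ.+-monoʳ-< i j<i))))
      (≤-reflexive (Σ-*ˡ i (toℚ (i ℕ.+ i)) (λ j → jump m j * jump m j)))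

    -- With y = v m (pr j) = x + d one has 2 x d = y² − x² − d², and Σ (y² - x²) vanishes around the cycle.
    secondMoment-step : ∀ m → M ℕ.≤ m →
      secondMoment (suc m) ≡ secondMoment m - 1/ℕ (suc m) * energy m + (1/ℕ (suc m) * 1/ℕ (suc m)) * rateEnergy m
    secondMoment-step m M≤m = begin
      Σ i (λ j → w j * (v (suc m) j * v (suc m) j))
        ≡⟨ Σ-cong i pointwise ⟩
      Σ i (λ j → (w j * (x j * x j) + b * ((y j * y j - x j * x j) - d j * d j)) + (b * b) * (rate j * (d j * d j)))
        ≡⟨ trans (Σ-+ i _ _) (cong (_+ Σ i (λ j → (b * b) * (rate j * (d j * d j)))) (Σ-+ i _ _)) ⟩
      (secondMoment m + Σ i (λ j → b * ((y j * y j - x j * x j) - d j * d j))) + Σ i (λ j → (b * b) * (rate j * (d j * d j)))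
        ≡⟨ cong₂ (λ p q → (secondMoment m + p) + q) cross (Σ-*ˡ i (b * b) _) ⟩
      secondMoment m + b * (0ℚ - energy m) + (b * b) * rateEnergy m
        ≡⟨ cong (λ z → z + (b * b) * rateEnergy m) (solve 3 (λ P b E → P :+ b :* (con 0ℚ :- E) := P :- b :* E) refl (secondMoment m) b (energy m)) ⟩
      secondMoment m - b * energy m + (b * b) * rateEnergy m ∎
      where
      open ≡-Reasoning
      b = 1/ℕ (suc m)
      x y d : ℕ → ℚ
      x j = v m j
      y j = v m (cyclePred i′ j)
      d = jump m
      cross : Σ i (λ j → b * ((y j * y j - x j * x j) - d j * d j)) ≡ b * (0ℚ - energy m)
      cross = trans (Σ-*ˡ i b _) (cong (b *_) (trans (Σ-- i _ _) (cong (_- energy m) (Σ-cyclePred-sub i′ (λ j → x j * x j)))))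
      pointwise : ∀ j → j ℕ.< i → w j * (v (suc m) j * v (suc m) j) ≡
        (w j * (x j * x j) + b * ((y j * y j - x j * x j) - d j * d j)) + (b * b) * (rate j * (d j * d j))
      pointwise j j<i rewrite v-step m M≤m j j<i = begin
        w j * ((x j + rate j * b * d j) * (x j + rate j * b * d j))
          ≡⟨ solve 5 (λ W C b x y → W :* ((x :+ C :* b :* (y :- x)) :* (x :+ C :* b :* (y :- x)))
                       := (W :* (x :* x) :+ (W :* C) :* (b :* ((y :* y :- x :* x) :- (y :- x) :* (y :- x))))
                          :+ (W :* C) :* ((b :* b) :* (C :* ((y :- x) :* (y :- x))))) refl (w j) (rate j) b (x j) (y j) ⟩
        (w j * (x j * x j) + (w j * rate j) * (b * ((y j * y j - x j * x j) - d j * d j))) + (w j * rate j) * ((b * b) * (rate j * (d j * d j)))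
          ≡⟨ cong (λ z → (w j * (x j * x j) + z * (b * ((y j * y j - x j * x j) - d j * d j))) + z * ((b * b) * (rate j * (d j * d j))))
                  (1/ℕ*toℚ≡1 (suc (i ℕ.+ j))) ⟩
        (w j * (x j * x j) + 1ℚ * (b * ((y j * y j - x j * x j) - d j * d j))) + 1ℚ * ((b * b) * (rate j * (d j * d j)))
          ≡⟨ cong₂ (λ p q → (w j * (x j * x j) + p) + q) (*-identityˡ _) (*-identityˡ _) ⟩
        (w j * (x j * x j) + b * ((y j * y j - x j * x j) - d j * d j)) + (b * b) * (rate j * (d j * d j)) ∎

    secondMoment-decrease : ∀ m → M ℕ.≤ m → 2 ℕ.* (i ℕ.+ i) ℕ.≤ suc m →
      secondMoment (suc m) ≤ secondMoment m - (1/ℕ (suc m) * 1/ℕ 2) * energy m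
    secondMoment-decrease m M≤m 4i≤1+m = begin
      secondMoment (suc m)
        ≡⟨ secondMoment-step m M≤m ⟩
      Ψ - b * E + (b * b) * rateEnergy m
        ≤⟨ +-monoʳ-≤ (Ψ - b * E) (*-monoˡ-≤-0≤ (b * b) (square-nonNeg b) (rateEnergy≤ m)) ⟩
      Ψ - b * E + (b * b) * (t * E)
        ≡⟨ cong (Ψ - b * E +_) (solve 3 (λ b t E → (b :* b) :* (t :* E) := b :* ((b :* t) :* E)) refl b t E) ⟩
      Ψ - b * E + b * ((b * t) * E)
        ≤⟨ +-monoʳ-≤ (Ψ - b * E) (*-monoˡ-≤-0≤ b (1/ℕ-nonNeg m) (*-monoʳ-≤-0≤ E (energy-nonNeg m) b*2i≤½)) ⟩
      Ψ - b * E + b * (1/ℕ 2 * E)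
        ≡⟨ solve 4 (λ P b h E → P :- b :* E :+ b :* (h :* E) := P :- (b :* h) :* E :+ (b :* E) :* ((h :+ h) :- con 1ℚ))
             refl Ψ b (1/ℕ 2) E ⟩
      Ψ - (b * 1/ℕ 2) * E + (b * E) * ((1/ℕ 2 + 1/ℕ 2) - 1ℚ)
        ≡⟨ cong (λ z → Ψ - (b * 1/ℕ 2) * E + (b * E) * (z - 1ℚ)) ½+½≡1 ⟩
      Ψ - (b * 1/ℕ 2) * E + (b * E) * (1ℚ - 1ℚ)
        ≡⟨ solve 3 (λ P X E → P :- X :+ E :* (con 1ℚ :- con 1ℚ) := P :- X) refl Ψ ((b * 1/ℕ 2) * E) (b * E) ⟩
      Ψ - (b * 1/ℕ 2) * E ∎
      where
      open ≤-Reasoning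
      Ψ = secondMoment m
      E = energy m
      b = 1/ℕ (suc m)
      t = toℚ (i ℕ.+ i)
      b*2i≤½ : b * t ≤ 1/ℕ 2
      b*2i≤½ = begin
        b * t                            ≤⟨ *-monoʳ-≤-0≤ t (toℚ-nonNeg (i ℕ.+ i))
                                              (1/ℕ-antimono-≤ {ℕ.pred (2 ℕ.* (i ℕ.+ i))} {m} (ℕ.≤-pred 4i≤1+m)) ⟩
        1/ℕ (2 ℕ.* (i ℕ.+ i)) * t        ≡⟨ cong (_* t) (1/ℕ-homo-* 1 (i′ ℕ.+ i)) ⟩
        1/ℕ 2 * 1/ℕ (i ℕ.+ i) * t        ≡⟨ *-assoc (1/ℕ 2) (1/ℕ (i ℕ.+ i)) t ⟩
        1/ℕ 2 * (1/ℕ (i ℕ.+ i) * t)      ≡⟨ cong (1/ℕ 2 *_) (1/ℕ*toℚ≡1 (i ℕ.+ i)) ⟩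
        1/ℕ 2 * 1ℚ                       ≡⟨ *-identityʳ (1/ℕ 2) ⟩
        1/ℕ 2                            ∎

    Z : ℚ
    Z = Σ i w

    Z-pos : 0ℚ < Z
    Z-pos = +-mono-≤-< (Σ-nonNeg i′ (λ j _ → 1/ℕ-nonNeg (i ℕ.+ j))) (1/ℕ-pos (i ℕ.+ i′))

    instance
      Z-nonZero : NonZero Z
      Z-nonZero = >-nonZero Z-pos

    Z⁻¹ : ℚ
    Z⁻¹ = 1/ Z

    Z⁻¹-pos : 0ℚ < Z⁻¹
    Z⁻¹-pos = 1/-pos Z Z-pos

    variance : ℕ → ℚ
    variance m = secondMoment m - Z⁻¹

    weighted-deviation : ∀ m → M ℕ.≤ m → ∀ a →
      Σ i (λ j → w j * ((v m j - a) * (v m j - a))) ≡ variance m + Z⁻¹ * ((1ℚ - a * Z) * (1ℚ - a * Z))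
    weighted-deviation m M≤m a = begin
      Σ i (λ j → w j * ((v m j - a) * (v m j - a)))
        ≡⟨ Σ-weighted-square i w (v m) a ⟩
      Ψ - (a + a) * Σ i (λ j → w j * v m j) + (a * a) * Z
        ≡⟨ cong (λ z → Ψ - (a + a) * z + (a * a) * Z) (mass m M≤m) ⟩
      Ψ - (a + a) * 1ℚ + (a * a) * Z
        ≡⟨ solve 3 (λ P a Z → P :- (a :+ a) :* con 1ℚ :+ (a :* a) :* Z := P :- (a :+ a) :* con 1ℚ :+ (a :* a :* Z) :* con 1ℚ) refl Ψ a Z ⟩
      Ψ - (a + a) * 1ℚ + (a * a * Z) * 1ℚ
        ≡⟨ cong (λ u → Ψ - (a + a) * u + (a * a * Z) * u) (sym (*-inverseˡ Z)) ⟩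
      Ψ - (a + a) * (Z⁻¹ * Z) + (a * a * Z) * (Z⁻¹ * Z)
        ≡⟨ solve 4 (λ P a Z Zi → P :- (a :+ a) :* (Zi :* Z) :+ (a :* a :* Z) :* (Zi :* Z)
                              := (P :- Zi) :+ Zi :* ((con 1ℚ :- a :* Z) :* (con 1ℚ :- a :* Z))) refl Ψ a Z Z⁻¹ ⟩
      variance m + Z⁻¹ * ((1ℚ - a * Z) * (1ℚ - a * Z)) ∎
      where
      open ≡-Reasoning
      Ψ = secondMoment m

    variance≡deviation : ∀ m → M ℕ.≤ m → Σ i (λ j → w j * ((v m j - Z⁻¹) * (v m j - Z⁻¹))) ≡ variance m
    variance≡deviation m M≤m = begin
      Σ i (λ j → w j * ((v m j - Z⁻¹) * (v m j - Z⁻¹)))     ≡⟨ weighted-deviation m M≤m Z⁻¹ ⟩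
      variance m + Z⁻¹ * ((1ℚ - Z⁻¹ * Z) * (1ℚ - Z⁻¹ * Z))  ≡⟨ cong (λ z → variance m + Z⁻¹ * ((1ℚ - z) * (1ℚ - z))) (*-inverseˡ Z) ⟩
      variance m + Z⁻¹ * ((1ℚ - 1ℚ) * (1ℚ - 1ℚ))           ≡⟨ cong (variance m +_) (*-zeroʳ Z⁻¹) ⟩
      variance m + 0ℚ                                        ≡⟨ +-identityʳ (variance m) ⟩
      variance m                                              ∎
      where open ≡-Reasoning

    variance-nonNeg : ∀ m → M ℕ.≤ m → 0ℚ ≤ variance m
    variance-nonNeg m M≤m = subst (0ℚ ≤_) (variance≡deviation m M≤m)
      (Σ-nonNeg i (λ j _ → *-nonNeg (w j) _ (1/ℕ-nonNeg (i ℕ.+ j)) (square-nonNeg (v m j - Z⁻¹))))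

    path-bound : ∀ m j → j ℕ.< i → (v m j - v m 0) * (v m j - v m 0) ≤ toℚ i * energy m
    path-bound m j j<i = begin
      (v m j - v m 0) * (v m j - v m 0)   ≡⟨ cong (λ z → z * z) (sym (Σ-telescope j (v m))) ⟩
      Σ j e * Σ j e                       ≤⟨ Σ-Cauchy-Schwarz j e ⟩
      toℚ j * Σ j (λ t → e t * e t)       ≤⟨ *-mono-≤-0≤ (toℚ-nonNeg j) (Σ-nonNeg j (λ t _ → square-nonNeg (e t)))
                                               (toℚ-mono-≤ (ℕ.<⇒≤ j<i)) (≤-trans Σⱼe²≤Σᵢ′e² Σe²≤energy) ⟩
      toℚ i * energy m                    ∎
      where
      open ≤-Reasoning
      e : ℕ → ℚ
      e t = v m (suc t) - v m t
      Σⱼe²≤Σᵢ′e² : Σ j (λ t → e t * e t) ≤ Σ i′ (λ t → e t * e t)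
      Σⱼe²≤Σᵢ′e² = Σ-≤-extend (λ t → e t * e t) (λ t → square-nonNeg (e t)) (ℕ.s≤s⁻¹ j<i)
      Σe²≤energy : Σ i′ (λ t → e t * e t) ≤ energy m
      Σe²≤energy = begin
        Σ i′ (λ t → e t * e t)
          ≡⟨ Σ-cong i′ (λ t _ → solve 2 (λ a b → (b :- a) :* (b :- a) := (a :- b) :* (a :- b)) refl (v m t) (v m (suc t))) ⟩
        S
          ≤⟨ subst (_≤ jump m 0 * jump m 0 + S) (+-identityˡ S) (+-monoˡ-≤ S (square-nonNeg (jump m 0))) ⟩
        jump m 0 * jump m 0 + S
          ≡⟨ sym (Σ-unfoldˡ i′ (λ j → jump m j * jump m j)) ⟩
        energy m ∎
        where
        S = Σ i′ (λ t → jump m (suc t) * jump m (suc t))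

    poincaré : ∀ m → M ℕ.≤ m → variance m ≤ toℚ i * (toℚ i * energy m)
    poincaré m M≤m = begin
      variance m                                             ≤⟨ p≤p+q (variance m) (*-nonNeg Z⁻¹ _ (<⇒≤ Z⁻¹-pos) (square-nonNeg (1ℚ - v m 0 * Z))) ⟩
      variance m + Z⁻¹ * ((1ℚ - v m 0 * Z) * (1ℚ - v m 0 * Z)) ≡⟨ sym (weighted-deviation m M≤m (v m 0)) ⟩
      Σ i (λ j → w j * ((v m j - v m 0) * (v m j - v m 0)))  ≤⟨ Σ-mono-≤ i (λ j j<i → ≤-trans (w*d²≤d² j) (path-bound m j j<i)) ⟩
      Σ i (λ _ → toℚ i * energy m)                           ≡⟨ Σ-const i (toℚ i * energy m) ⟩
      toℚ i * (toℚ i * energy m)                             ∎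
      where
      open ≤-Reasoning
      w*d²≤d² : ∀ j → w j * ((v m j - v m 0) * (v m j - v m 0)) ≤ (v m j - v m 0) * (v m j - v m 0)
      w*d²≤d² j = subst (w j * d² ≤_) (*-identityˡ d²) (*-monoʳ-≤-0≤ d² (square-nonNeg (v m j - v m 0)) (1/ℕ≤1 (i ℕ.+ j)))
        where
        d² = (v m j - v m 0) * (v m j - v m 0)

    α : ℚ
    α = 1/ℕ 2 * 1/ℕ (i ℕ.* i)

    variance-decay : ∀ m → 2 ℕ.* (i ℕ.+ i) ℕ.+ M ℕ.≤ m → variance (suc m) ≤ variance m - α * 1/ℕ (suc m) * variance m
    variance-decay m M₁≤m = begin
      secondMoment (suc m) - Z⁻¹
        ≤⟨ +-monoˡ-≤ (- Z⁻¹) (secondMoment-decrease m M≤m 4i≤1+m) ⟩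
      secondMoment m - (b * 1/ℕ 2) * energy m - Z⁻¹
        ≡⟨ solve 4 (λ P X E Zi → P :- X :* E :- Zi := (P :- Zi) :- X :* E) refl (secondMoment m) (b * 1/ℕ 2) (energy m) Z⁻¹ ⟩
      variance m - (b * 1/ℕ 2) * energy m
        ≤⟨ +-monoʳ-≤ (variance m) (neg-antimono-≤ (*-monoˡ-≤-0≤ (b * 1/ℕ 2) 0≤b/2 variance≤i²energy)) ⟩
      variance m - (b * 1/ℕ 2) * (1/ℕ (i ℕ.* i) * variance m)
        ≡⟨ cong (λ z → variance m - z) (solve 4 (λ b h k D → (b :* h) :* (k :* D) := (h :* k) :* b :* D) refl b (1/ℕ 2) (1/ℕ (i ℕ.* i)) (variance m)) ⟩
      variance m - α * b * variance m ∎
      where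
      open ≤-Reasoning
      b = 1/ℕ (suc m)
      0≤b/2 : 0ℚ ≤ b * 1/ℕ 2
      0≤b/2 = *-nonNeg b (1/ℕ 2) (1/ℕ-nonNeg m) (1/ℕ-nonNeg 1)
      M≤m : M ℕ.≤ m
      M≤m = ℕ.≤-trans (ℕ.m≤n+m M _) M₁≤m
      4i≤1+m : 2 ℕ.* (i ℕ.+ i) ℕ.≤ suc m
      4i≤1+m = ℕ.≤-trans (ℕ.m≤m+n _ M) (ℕ.≤-trans M₁≤m (ℕ.n≤1+n m))
      variance≤i²energy : 1/ℕ (i ℕ.* i) * variance m ≤ energy m
      variance≤i²energy = begin
        1/ℕ (i ℕ.* i) * variance m
          ≤⟨ *-monoˡ-≤-0≤ (1/ℕ (i ℕ.* i)) (1/ℕ-nonNeg (ℕ.pred (i ℕ.* i))) (poincaré m M≤m) ⟩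
        1/ℕ (i ℕ.* i) * (toℚ i * (toℚ i * energy m))
          ≡⟨ cong (1/ℕ (i ℕ.* i) *_) (trans (sym (*-assoc (toℚ i) (toℚ i) (energy m))) (cong (_* energy m) (sym (toℚ-homo-* i i)))) ⟩
        1/ℕ (i ℕ.* i) * (toℚ (i ℕ.* i) * energy m)       ≡⟨ sym (*-assoc (1/ℕ (i ℕ.* i)) (toℚ (i ℕ.* i)) (energy m)) ⟩
        1/ℕ (i ℕ.* i) * toℚ (i ℕ.* i) * energy m         ≡⟨ cong (_* energy m) (1/ℕ*toℚ≡1 (i ℕ.* i)) ⟩
        1ℚ * energy m                                    ≡⟨ *-identityˡ (energy m) ⟩
        energy m                                         ∎

    variance→0 : TendsToZero variance
    variance→0 = decay⇒tendsToZero variance M₁ α (λ m M₁≤m → variance-nonNeg m (ℕ.≤-trans (ℕ.m≤n+m M _) M₁≤m))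
                   variance-decay (*-pos (1/ℕ 2) (1/ℕ (i ℕ.* i)) (1/ℕ-pos 1) (1/ℕ-pos (ℕ.pred (i ℕ.* i))))
      where
      M₁ = 2 ℕ.* (i ℕ.+ i) ℕ.+ M

    functional-deviation : ∀ (c : ℕ → ℚ) → (∀ j → j ℕ.< i → c j * c j ≤ w j) → ∀ m → M ℕ.≤ m →
      (Σ i (λ j → c j * v m j) - Z⁻¹ * Σ i c) * (Σ i (λ j → c j * v m j) - Z⁻¹ * Σ i c) ≤ toℚ i * variance m
    functional-deviation c c²≤w m M≤m = begin
      (Σ i (λ j → c j * v m j) - Z⁻¹ * Σ i c) * (Σ i (λ j → c j * v m j) - Z⁻¹ * Σ i c)
        ≡⟨ cong (λ z → z * z) Σe ⟩
      Σ i e * Σ i e                      ≤⟨ Σ-Cauchy-Schwarz i e ⟩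
      toℚ i * Σ i (λ j → e j * e j)      ≤⟨ *-monoˡ-≤-0≤ (toℚ i) (toℚ-nonNeg i) (Σ-mono-≤ i e²≤w*d²) ⟩
      toℚ i * Σ i (λ j → w j * ((v m j - Z⁻¹) * (v m j - Z⁻¹))) ≡⟨ cong (toℚ i *_) (variance≡deviation m M≤m) ⟩
      toℚ i * variance m                 ∎
      where
      open ≤-Reasoning
      e : ℕ → ℚ
      e j = c j * (v m j - Z⁻¹)
      Σe : Σ i (λ j → c j * v m j) - Z⁻¹ * Σ i c ≡ Σ i e
      Σe = begin-equality
        Σ i (λ j → c j * v m j) - Z⁻¹ * Σ i c        ≡⟨ cong (λ z → Σ i (λ j → c j * v m j) - z) (sym (Σ-*ˡ i Z⁻¹ c)) ⟩
        Σ i (λ j → c j * v m j) - Σ i (λ j → Z⁻¹ * c j) ≡⟨ sym (Σ-- i _ _) ⟩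
        Σ i (λ j → c j * v m j - Z⁻¹ * c j)         ≡⟨ Σ-cong i (λ j _ → solve 3 (λ c x z → c :* x :- z :* c := c :* (x :- z)) refl (c j) (v m j) Z⁻¹) ⟩
        Σ i e                                        ∎
      e²≤w*d² : ∀ j → j ℕ.< i → e j * e j ≤ w j * ((v m j - Z⁻¹) * (v m j - Z⁻¹))
      e²≤w*d² j j<i = begin
        e j * e j                                   ≡⟨ solve 2 (λ c d → (c :* d) :* (c :* d) := (d :* d) :* (c :* c)) refl (c j) (v m j - Z⁻¹) ⟩
        d² * (c j * c j)                            ≤⟨ *-monoˡ-≤-0≤ d² (square-nonNeg (v m j - Z⁻¹)) (c²≤w j j<i) ⟩
        d² * w j                                    ≡⟨ *-comm d² (w j) ⟩
        w j * d²                                    ∎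
        where
        d² = (v m j - Z⁻¹) * (v m j - Z⁻¹)

    functional→limit : ∀ (c : ℕ → ℚ) → (∀ j → j ℕ.< i → c j * c j ≤ w j) →
      TendsToZero (λ m → (Σ i (λ j → c j * v m j) - Z⁻¹ * Σ i c) * (Σ i (λ j → c j * v m j) - Z⁻¹ * Σ i c))
    functional→limit c c²≤w δ 0<δ = N ℕ.+ M , F²<δ
      where
      F : ℕ → ℚ
      F m = Σ i (λ j → c j * v m j) - Z⁻¹ * Σ i c
      variance-small = variance→0 (δ * 1/ℕ i) (*-pos δ (1/ℕ i) 0<δ (1/ℕ-pos i′))
      N = proj₁ variance-small
      F²<δ : ∀ m → N ℕ.+ M ℕ.≤ m → F m * F m < δ
      F²<δ m N+M≤m = begin-strict
        F m * F m                     ≤⟨ functional-deviation c c²≤w m (ℕ.≤-trans (ℕ.m≤n+m M N) N+M≤m) ⟩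
        toℚ i * variance m            <⟨ *-monoʳ-<-pos (toℚ i) {{positive (toℚ-pos i′)}} (proj₂ variance-small m (ℕ.≤-trans (ℕ.m≤m+n N M) N+M≤m)) ⟩
        toℚ i * (δ * 1/ℕ i)           ≡⟨ solve 3 (λ t d v → t :* (d :* v) := d :* (v :* t)) refl (toℚ i) δ (1/ℕ i) ⟩
        δ * (1/ℕ i * toℚ i)           ≡⟨ trans (cong (δ *_) (1/ℕ*toℚ≡1 i)) (*-identityʳ δ) ⟩
        δ                             ∎
        where open ≤-Reasoning

module Blocks where

  open RationalFacts
  open Expectation
  open import Data.Nat as ℕ using (ℕ; zero; suc; _+_; _*_; _≤_; _<_; _≤?_; z≤n; s≤s; _∸_; _≡ᵇ_)
  open import Data.Nat.Properties
  open import Data.Nat.DivMod using (_/_; _%_; m*n%n≡0; m*n/n≡m; /-monoˡ-≤; m<n*o⇒m/o<n)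
  import Data.Rational as ℚ
  import Data.Rational.Properties as ℚ
  open import Relation.Binary.PropositionalEquality
  open import Relation.Nullary using (yes; no; ¬_)
  open import Data.Empty using (⊥-elim)
  open import Data.Sum using (inj₁; inj₂)
  open import Data.Bool using (true; false; if_then_else_; T)
  open import Data.Unit using (tt)
  open import Data.Product using (_×_; _,_; proj₂; Σ-syntax)
  open import Data.List using ([]; _∷_; _++_)
  open import Data.List.Relation.Unary.All as All using (All; []; _∷_)
  import Data.List.Relation.Unary.All.Properties as All
  open import Data.Nat.ListAction using (sum)
  open import Data.Nat.ListAction.Properties using (sum-++)
  open import Data.Nat.Solver using (module +-*-Solver)
  open +-*-Solver

  newBlocks-fit : ∀ B r ℓ → r + ℓ ≤ B → newBlocks B r ℓ ≡ (r + ℓ) ∷ []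
  newBlocks-fit B r ℓ fit with r + ℓ ≤? B
  ... | yes _   = refl
  ... | no ¬fit = ⊥-elim (¬fit fit)

  newBlocks-split : ∀ B r ℓ → ¬ (r + ℓ ≤ B) → newBlocks B r ℓ ≡ evenSplit (r + ℓ) (ceilDiv (r + ℓ) B)
  newBlocks-split B r ℓ ¬fit with r + ℓ ≤? B
  ... | yes fit = ⊥-elim (¬fit fit)
  ... | no _    = refl

  ceilDiv≡2 : ∀ n B → B < n → n ≤ 2 * B → ceilDiv n B ≡ 2
  ceilDiv≡2 n zero    B<n n≤2B = ⊥-elim (<-irrefl refl (<-≤-trans B<n n≤2B))
  ceilDiv≡2 n (suc b) B<n n≤2B = ≤-antisym (<⇒≤pred (m<n*o⇒m/o<n upper)) lower
    where
    lower : 2 ≤ (n + b) / suc b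
    lower = subst (_≤ (n + b) / suc b) (m*n/n≡m 2 (suc b))
      (/-monoˡ-≤ (suc b) (subst (_≤ n + b) (solve 1 (λ b → (con 2 :+ b) :+ b := con 2 :* (con 1 :+ b)) refl b) (+-monoˡ-≤ b B<n)))
    upper : n + b < 3 * suc b
    upper = subst (n + b <_) (solve 1 (λ b → con 1 :+ (con 2 :* (con 1 :+ b) :+ b) := con 3 :* (con 1 :+ b)) refl b)
      (s≤s (+-monoˡ-≤ b n≤2B))

  evenSplit-halves : ∀ x → evenSplit (x * 2) 2 ≡ x ∷ x ∷ []
  evenSplit-halves x with x * 2 % 2 | m*n%n≡0 x 2 | x * 2 / 2 | m*n/n≡m x 2
  ... | _ | refl | _ | refl = refl

  module Process (B i′ r′ : ℕ) (fits : (suc i′ + i′) * suc r′ ≤ B) (overflows : B < (suc i′ + suc i′) * suc r′) where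

    i r M₀ : ℕ
    i  = suc i′
    r  = suc r′
    M₀ = suc (i + i′)

    grow : ∀ k → suc k ≤ i + i′ → newBlocks B r (k * r) ≡ (suc k * r) ∷ []
    grow k k<2i-1 = newBlocks-fit B r (k * r) (≤-trans (*-monoˡ-≤ r k<2i-1) fits)

    r+[2i-1]r≡2ir : r + (i + i′) * r ≡ (i + i) * r
    r+[2i-1]r≡2ir = solve 2 (λ a b → (con 1 :+ b) :+ ((con 1 :+ a) :+ a) :* (con 1 :+ b) := ((con 1 :+ a) :+ (con 1 :+ a)) :* (con 1 :+ b)) refl i′ r′

    split : newBlocks B r ((i + i′) * r) ≡ (i * r) ∷ (i * r) ∷ []
    split = begin
      newBlocks B r ((i + i′) * r)                                   ≡⟨ newBlocks-split B r _ ¬fit ⟩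
      evenSplit (r + (i + i′) * r) (ceilDiv (r + (i + i′) * r) B)    ≡⟨ cong (evenSplit (r + (i + i′) * r)) two-blocks ⟩
      evenSplit (r + (i + i′) * r) 2                                 ≡⟨ cong (λ n → evenSplit n 2) (trans r+[2i-1]r≡2ir (solve 2 (λ a b → (a :+ a) :* b := (a :* b) :* con 2) refl i r)) ⟩
      evenSplit ((i * r) * 2) 2                                      ≡⟨ evenSplit-halves (i * r) ⟩
      (i * r) ∷ (i * r) ∷ []                                         ∎
      where
      open ≡-Reasoning
      ¬fit : ¬ (r + (i + i′) * r ≤ B)
      ¬fit fit = <-irrefl refl (<-≤-trans overflows (subst (_≤ B) r+[2i-1]r≡2ir fit))
      two-blocks : ceilDiv (r + (i + i′) * r) B ≡ 2
      two-blocks = ceilDiv≡2 _ B (subst (B <_) (sym r+[2i-1]r≡2ir) overflows)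
        (subst (r + (i + i′) * r ≤_) (cong (B +_) (sym (+-identityʳ B))) (+-mono-≤ (≤-trans (m≤n*m r (i + i′)) fits) fits))

    choiceProb-single : ∀ m → ℚ.1ℚ ℚ.* choiceProb ((m * r) ∷ []) (m * r) ≡ ℚ.1ℚ
    choiceProb-single zero    = refl
    choiceProb-single (suc m) = trans (ℚ.*-identityˡ _)
      (trans (choiceProb-keys ((suc m * r) ∷ []) (suc m * r) (r′ + m * r) (+-identityʳ _)) (toℚ*1/ℕ≡1 (suc m * r)))

    dist-growing : ∀ m → m ≤ i + i′ → dist B r m ≡ (ℚ.1ℚ , (m * r) ∷ []) ∷ []
    dist-growing zero    _       = refl
    dist-growing (suc m) m<2i-1 rewrite dist-growing m (≤-trans (n≤1+n m) m<2i-1) =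
      cong₂ (λ p s → (p , s) ∷ []) (choiceProb-single m) (cong (_++ []) (grow m m<2i-1))

    dist-split : dist B r M₀ ≡ (ℚ.1ℚ , (i * r) ∷ (i * r) ∷ []) ∷ []
    dist-split rewrite dist-growing (i + i′) ≤-refl =
      cong₂ (λ p s → (p , s) ∷ []) (choiceProb-single (i + i′)) (cong (_++ []) split)

    size : ℕ → ℕ
    size j = (i + j) * r

    Admissible : ℕ → Set
    Admissible ℓ = Σ[ j ∈ ℕ ] (j < i × ℓ ≡ size j)

    ir-admissible : Admissible (i * r)
    ir-admissible = 0 , s≤s z≤n , cong (_* r) (sym (+-identityʳ i))

    sum-halves : (i * r) + ((i * r) + 0) ≡ r + (i + i′) * r
    sum-halves = solve 2 (λ a b → ((con 1 :+ a) :* (con 1 :+ b)) :+ (((con 1 :+ a) :* (con 1 :+ b)) :+ con 0)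
                               := (con 1 :+ b) :+ ((con 1 :+ a) :+ a) :* (con 1 :+ b)) refl i′ r′

    newBlocks-admissible : ∀ j → j < i → All Admissible (newBlocks B r (size j)) × sum (newBlocks B r (size j)) ≡ r + size j
    newBlocks-admissible j j<i with m<1+n⇒m<n∨m≡n j<i
    ... | inj₁ j<i′ rewrite grow (i + j) (+-monoʳ-< i j<i′) =
      ((suc j , s≤s j<i′ , cong (_* r) (sym (+-suc i j))) ∷ []) , +-identityʳ _
    ... | inj₂ refl rewrite split = (ir-admissible ∷ ir-admissible ∷ []) , sum-halves

    KeyCount : ℕ → Config → Set
    KeyCount n s = All Admissible s × sum s ≡ n

    outcomes-admissible : ∀ s → All Admissible s → All (λ o → KeyCount (r + sum s) (proj₂ o)) (outcomes B r s)
    outcomes-admissible []      []                 = []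
    outcomes-admissible (ℓ ∷ s) (ℓ-adm@(j , j<i , refl) ∷ s-adm) with newBlocks-admissible j j<i
    ... | new-adm , new-sum =
      (All.++⁺ new-adm s-adm , trans (sum-++ (newBlocks B r ℓ) s) (trans (cong (_+ sum s) new-sum) (+-assoc r ℓ (sum s))))
      ∷ All.map⁺ (All.map (λ { (adm , keys) → ℓ-adm ∷ adm , trans (cong (ℓ +_) keys) (solve 3 (λ l r S → l :+ (r :+ S) := r :+ (l :+ S)) refl ℓ r (sum s)) })
                          (outcomes-admissible s s-adm))

    WellFormed : ℕ → ℚ.ℚ × Config → Set
    WellFormed m (_ , s) = KeyCount (m * r) s

    step-wellFormed : ∀ m d → All (WellFormed m) d → All (WellFormed (suc m)) (step B r d)
    step-wellFormed m d wf = All.concat⁺ (All.map⁺ (All.map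
      (λ { {p , s} (adm , keys) → All.map⁺ (All.map (λ { (adm′ , keys′) → adm′ , trans keys′ (cong (r +_) keys) })
                                                     (outcomes-admissible s adm)) }) wf))

    dist-wellFormed : ∀ m → M₀ ≤ m → All (WellFormed m) (dist B r m)
    dist-wellFormed m M₀≤m = subst (λ n → All (WellFormed n) (dist B r n)) (m∸n+n≡m M₀≤m) (after (m ∸ M₀))
      where
      after : ∀ k → All (WellFormed (k + M₀)) (dist B r (k + M₀))
      after zero    rewrite dist-split = ((ir-admissible ∷ ir-admissible ∷ []) , sum-halves) ∷ []
      after (suc k) = step-wellFormed (k + M₀) (dist B r (k + M₀)) (after k)

    isSize : ℕ → ℕ → ℚ.ℚ
    isSize j ℓ = if ℓ ≡ᵇ size j then ℚ.1ℚ else ℚ.0ℚ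

    isSize-≡ : ∀ j ℓ → ℓ ≡ size j → isSize j ℓ ≡ ℚ.1ℚ
    isSize-≡ j ℓ ℓ≡ with ℓ ≡ᵇ size j | ≡⇒≡ᵇ ℓ (size j) ℓ≡
    ... | true | _ = refl

    isSize-≢ : ∀ j j′ ℓ → ℓ ≡ size j′ → j′ ≢ j → isSize j ℓ ≡ ℚ.0ℚ
    isSize-≢ j j′ _ refl j′≢j with size j′ ≡ᵇ size j in eq
    ... | false = refl
    ... | true  = ⊥-elim (j′≢j (+-cancelˡ-≡ i j′ j (*-cancelʳ-≡ (i + j′) (i + j) r (≡ᵇ⇒≡ _ _ (subst T (sym eq) tt)))))

open import Data.Nat as ℕ using (ℕ; suc)

module ExpectedCounts (B i′ r′ : ℕ) (fits : (suc i′ ℕ.+ i′) ℕ.* suc r′ ℕ.≤ B)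
                      (overflows : B ℕ.< (suc i′ ℕ.+ suc i′) ℕ.* suc r′) where

  open RationalFacts
  open FiniteSums
  open Expectation
  open Cycles using (cyclePred; cyclePred-<)
  open Blocks
  open import Data.Nat as ℕ using (ℕ; zero; suc; z≤n; s≤s)
  import Data.Nat.Properties as ℕ
  open import Data.Rational
  open import Data.Rational.Properties
  open import Relation.Binary.PropositionalEquality
  open import Data.Empty using (⊥-elim)
  open import Data.Sum using (inj₁; inj₂)
  open import Data.Product using (_,_; proj₁; proj₂)
  open import Data.List using ([]; _∷_)
  open import Data.List.Relation.Unary.All as All using (All; []; _∷_)
  open import Data.Rational.Solver using (module +-*-Solver)
  open +-*-Solver

  open Process B i′ r′ fits overflows

  blockSum-admissible : ∀ h s → All Admissible s → blockSum h s ≡ Σ i (λ j → h (size j) * blockSum (isSize j) s)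
  blockSum-admissible h []      []                          = sym (trans (Σ-cong i (λ j _ → *-zeroʳ (h (size j)))) (Σ-0 i))
  blockSum-admissible h (ℓ ∷ s) ((j₀ , j₀<i , refl) ∷ s-adm) = sym (begin
    Σ i (λ j → h (size j) * (isSize j (size j₀) + blockSum (isSize j) s))
      ≡⟨ Σ-cong i (λ j _ → *-distribˡ-+ (h (size j)) _ _) ⟩
    Σ i (λ j → h (size j) * isSize j (size j₀) + h (size j) * blockSum (isSize j) s)
      ≡⟨ Σ-+ i _ _ ⟩
    Σ i (λ j → h (size j) * isSize j (size j₀)) + Σ i (λ j → h (size j) * blockSum (isSize j) s)
      ≡⟨ cong₂ _+_ (Σ-single i _ j₀ j₀<i (λ j _ j≢j₀ → trans (cong (h (size j) *_) (isSize-≢ j j₀ (size j₀) refl (≢-sym j≢j₀))) (*-zeroʳ (h (size j)))))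
                   (sym (blockSum-admissible h s s-adm)) ⟩
    h (size j₀) * isSize j₀ (size j₀) + blockSum h s
      ≡⟨ cong (λ z → h (size j₀) * z + blockSum h s) (isSize-≡ j₀ (size j₀) refl) ⟩
    h (size j₀) * 1ℚ + blockSum h s
      ≡⟨ cong (_+ blockSum h s) (*-identityʳ (h (size j₀))) ⟩
    h (size j₀) + blockSum h s ∎)
    where open ≡-Reasoning

  DistAdmissible : Dist → Set
  DistAdmissible = All (λ ps → All Admissible (proj₂ ps))

  expect-admissible : ∀ h d → DistAdmissible d → expect h d ≡ Σ i (λ j → h (size j) * expect (isSize j) d)
  expect-admissible h []            []               = sym (trans (Σ-cong i (λ j _ → *-zeroʳ (h (size j)))) (Σ-0 i))
  expect-admissible h ((p , s) ∷ d) (s-adm ∷ d-adm) = begin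
    p * blockSum h s + expect h d
      ≡⟨ cong₂ _+_ (trans (cong (p *_) (blockSum-admissible h s s-adm)) (sym (Σ-*ˡ i p _))) (expect-admissible h d d-adm) ⟩
    Σ i (λ j → p * (h (size j) * blockSum (isSize j) s)) + Σ i (λ j → h (size j) * expect (isSize j) d)
      ≡⟨ sym (Σ-+ i _ _) ⟩
    Σ i (λ j → p * (h (size j) * blockSum (isSize j) s) + h (size j) * expect (isSize j) d)
      ≡⟨ Σ-cong i (λ j _ → solve 4 (λ p h F E → p :* (h :* F) :+ h :* E := h :* (p :* F :+ E)) refl p (h (size j)) (blockSum (isSize j) s) (expect (isSize j) d)) ⟩
    Σ i (λ j → h (size j) * (p * blockSum (isSize j) s + expect (isSize j) d)) ∎
    where open ≡-Reasoning

  dist-admissible : ∀ m → M₀ ℕ.≤ m → DistAdmissible (dist B r m)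
  dist-admissible m M₀≤m = All.map proj₁ (dist-wellFormed m M₀≤m)

  pr : ℕ → ℕ
  pr = cyclePred i′

  splitCount : ℕ → ℚ
  splitCount zero    = 1ℚ + 1ℚ
  splitCount (suc _) = 1ℚ

  newBlocks-pred : ∀ j → j ℕ.< i → blockSum (isSize j) (newBlocks B r (size (pr j))) ≡ splitCount j
  newBlocks-pred zero _ rewrite split | isSize-≡ 0 (i ℕ.* r) (proj₂ (proj₂ ir-admissible)) = cong (1ℚ +_) (+-identityʳ 1ℚ)
  newBlocks-pred (suc j) (s≤s j<i′) rewrite grow (i ℕ.+ j) (ℕ.+-monoʳ-< i j<i′)
    | isSize-≡ (suc j) (suc (i ℕ.+ j) ℕ.* r) (cong (ℕ._* r) (sym (ℕ.+-suc i j))) = +-identityʳ 1ℚ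

  newBlocks-other : ∀ j j′ → j′ ℕ.< i → j′ ≢ pr j → blockSum (isSize j) (newBlocks B r (size j′)) ≡ 0ℚ
  newBlocks-other j j′ j′<i j′≢pr with ℕ.m<1+n⇒m<n∨m≡n j′<i
  ... | inj₁ j′<i′ rewrite grow (i ℕ.+ j′) (ℕ.+-monoʳ-< i j′<i′)
    | isSize-≢ j (suc j′) (suc (i ℕ.+ j′) ℕ.* r) (cong (ℕ._* r) (sym (ℕ.+-suc i j′))) (λ e → j′≢pr (cong pr e)) = +-identityʳ 0ℚ
  newBlocks-other zero    j′ j′<i j′≢pr | inj₂ refl = ⊥-elim (j′≢pr refl)
  newBlocks-other (suc j) j′ j′<i j′≢pr | inj₂ refl rewrite split
    | isSize-≢ (suc j) 0 (i ℕ.* r) (proj₂ (proj₂ ir-admissible)) (λ ()) = refl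

  count : ℕ → ℕ → ℚ
  count m j = expect (isSize j) (dist B r m)

  drift-isSize : ∀ m → M₀ ℕ.≤ m → ∀ j → j ℕ.< i →
    expect (drift B r (isSize j)) (dist B r m) ≡ toℚ (size (pr j)) * splitCount j * count m (pr j) - toℚ (size j) * count m j
  drift-isSize m M₀≤m j j<i = begin
    expect (drift B r (isSize j)) (dist B r m)
      ≡⟨ expect-admissible _ (dist B r m) (dist-admissible m M₀≤m) ⟩
    Σ i (λ j′ → toℚ (size j′) * (N j′ - isSize j (size j′)) * x j′)
      ≡⟨ Σ-cong i (λ j′ _ → solve 4 (λ t a b y → t :* (a :- b) :* y := t :* a :* y :- t :* b :* y) refl (toℚ (size j′)) (N j′) (isSize j (size j′)) (x j′)) ⟩
    Σ i (λ j′ → toℚ (size j′) * N j′ * x j′ - toℚ (size j′) * isSize j (size j′) * x j′)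
      ≡⟨ Σ-- i _ _ ⟩
    Σ i (λ j′ → toℚ (size j′) * N j′ * x j′) - Σ i (λ j′ → toℚ (size j′) * isSize j (size j′) * x j′)
      ≡⟨ cong₂ _-_ (Σ-single i _ (pr j) (cyclePred-< i′ j j<i) (λ j′ j′<i j′≢pr → vanish (N j′) (newBlocks-other j j′ j′<i j′≢pr)))
                   (Σ-single i _ j j<i (λ j′ _ j′≢j → vanish (isSize j (size j′)) (isSize-≢ j j′ (size j′) refl j′≢j))) ⟩
    toℚ (size (pr j)) * N (pr j) * x (pr j) - toℚ (size j) * isSize j (size j) * x j
      ≡⟨ cong₂ (λ u z → toℚ (size (pr j)) * u * x (pr j) - toℚ (size j) * z * x j) (newBlocks-pred j j<i) (isSize-≡ j (size j) refl) ⟩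
    toℚ (size (pr j)) * splitCount j * x (pr j) - toℚ (size j) * 1ℚ * x j
      ≡⟨ cong (λ z → toℚ (size (pr j)) * splitCount j * x (pr j) - z * x j) (*-identityʳ (toℚ (size j))) ⟩
    toℚ (size (pr j)) * splitCount j * x (pr j) - toℚ (size j) * x j ∎
    where
    open ≡-Reasoning
    x = count m
    N : ℕ → ℚ
    N j′ = blockSum (isSize j) (newBlocks B r (size j′))
    vanish : ∀ {j′} a → a ≡ 0ℚ → toℚ (size j′) * a * x j′ ≡ 0ℚ
    vanish {j′} a a≡0 rewrite a≡0 = solve 2 (λ t y → t :* con 0ℚ :* y := con 0ℚ) refl (toℚ (size j′)) (x j′)

  count-step : ∀ n → M₀ ℕ.≤ suc n → ∀ j → j ℕ.< i →
    count (suc (suc n)) j ≡ count (suc n) j + 1/ℕ (suc n) * (toℚ (i ℕ.+ pr j) * splitCount j * count (suc n) (pr j) - toℚ (i ℕ.+ j) * count (suc n) j)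
  count-step n M₀≤m j j<i = begin
    expect (isSize j) (step B r (dist B r m))
      ≡⟨ expect-step B r (r′ ℕ.+ n ℕ.* r) (isSize j) (dist B r m) (All.map proj₂ (dist-wellFormed m M₀≤m)) ⟩
    x j + 1/ℕ (m ℕ.* r) * expect (drift B r (isSize j)) (dist B r m)
      ≡⟨ cong (λ z → x j + 1/ℕ (m ℕ.* r) * z) (drift-isSize m M₀≤m j j<i) ⟩
    x j + 1/ℕ (m ℕ.* r) * (toℚ (size (pr j)) * μ * x (pr j) - toℚ (size j) * x j)
      ≡⟨ cong (x j +_) keys-scale ⟩
    x j + 1/ℕ m * (k′ * μ * x (pr j) - k * x j) ∎
    where
    open ≡-Reasoning
    m = suc n
    x = count m
    μ = splitCount j
    k = toℚ (i ℕ.+ j)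
    k′ = toℚ (i ℕ.+ pr j)
    R = toℚ r
    keys-scale : 1/ℕ (m ℕ.* r) * (toℚ (size (pr j)) * μ * x (pr j) - toℚ (size j) * x j) ≡ 1/ℕ m * (k′ * μ * x (pr j) - k * x j)
    keys-scale = begin
      1/ℕ (m ℕ.* r) * (toℚ (size (pr j)) * μ * x (pr j) - toℚ (size j) * x j)
        ≡⟨ cong₂ (λ a b → a * (b * μ * x (pr j) - toℚ (size j) * x j)) (1/ℕ-homo-* n r′) (toℚ-homo-* (i ℕ.+ pr j) r) ⟩
      (1/ℕ m * 1/ℕ r) * ((k′ * R) * μ * x (pr j) - toℚ (size j) * x j)
        ≡⟨ cong (λ b → (1/ℕ m * 1/ℕ r) * ((k′ * R) * μ * x (pr j) - b * x j)) (toℚ-homo-* (i ℕ.+ j) r) ⟩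
      (1/ℕ m * 1/ℕ r) * ((k′ * R) * μ * x (pr j) - (k * R) * x j)
        ≡⟨ solve 8 (λ a b R k′ k u y z → (a :* b) :* ((k′ :* R) :* u :* y :- (k :* R) :* z) := (a :* (k′ :* u :* y :- k :* z)) :* (b :* R))
             refl (1/ℕ m) (1/ℕ r) R k′ k μ (x (pr j)) (x j) ⟩
      (1/ℕ m * (k′ * μ * x (pr j) - k * x j)) * (1/ℕ r * R)
        ≡⟨ cong ((1/ℕ m * (k′ * μ * x (pr j) - k * x j)) *_) (1/ℕ*toℚ≡1 r) ⟩
      (1/ℕ m * (k′ * μ * x (pr j) - k * x j)) * 1ℚ
        ≡⟨ *-identityʳ _ ⟩
      1/ℕ m * (k′ * μ * x (pr j) - k * x j) ∎

  rate : ℕ → ℚ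
  rate j = toℚ (suc (i ℕ.+ j))

  normalized : ℕ → ℕ → ℚ
  normalized zero    j = 0ℚ
  normalized (suc n) j = toℚ (i ℕ.+ j) * rate j * count (suc n) j * 1/ℕ (suc n)

  inflow-rate : ∀ j → toℚ (i ℕ.+ j) * splitCount j ≡ rate (pr j)
  inflow-rate zero    = begin
    toℚ (i ℕ.+ 0) * (1ℚ + 1ℚ)        ≡⟨ solve 1 (λ k → k :* (con 1ℚ :+ con 1ℚ) := k :+ k) refl (toℚ (i ℕ.+ 0)) ⟩
    toℚ (i ℕ.+ 0) + toℚ (i ℕ.+ 0)    ≡⟨ sym (toℚ-homo-+ (i ℕ.+ 0) (i ℕ.+ 0)) ⟩
    toℚ ((i ℕ.+ 0) ℕ.+ (i ℕ.+ 0))    ≡⟨ cong toℚ (trans (cong₂ ℕ._+_ (ℕ.+-identityʳ i) (ℕ.+-identityʳ i)) (ℕ.+-suc i i′)) ⟩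
    rate i′                          ∎
    where open ≡-Reasoning
  inflow-rate (suc j) = trans (*-identityʳ _) (cong toℚ (ℕ.+-suc i j))

  normalized-step : ∀ m → M₀ ℕ.≤ m → ∀ j → j ℕ.< i →
    normalized (suc m) j ≡ normalized m j + rate j * 1/ℕ (suc m) * (normalized m (pr j) - normalized m j)
  normalized-step (suc n) M₀≤m j j<i = begin
    k * c * count (suc m) j * b
      ≡⟨ cong (λ z → k * c * z * b) (count-step n M₀≤m j j<i) ⟩
    k * c * (x + a * (k′ * μ * y - k * x)) * b
      ≡⟨ solve 9 (λ k c k′ c′ μ a b x y →
           k :* c :* (x :+ a :* (k′ :* μ :* y :- k :* x)) :* b
           := (k :* c :* x :* a :+ c :* b :* (k′ :* c′ :* y :* a :- k :* c :* x :* a))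
              :+ (c :* b :* a :* k′ :* y) :* (k :* μ :- c′) :+ (k :* c :* x) :* (b :- a :+ a :* b :* (c :- k)))
           refl k c k′ c′ μ a b x y ⟩
    RHS + (c * b * a * k′ * y) * (k * μ - c′) + (k * c * x) * (b - a + a * b * (c - k))
      ≡⟨ cong₂ (λ p q → RHS + (c * b * a * k′ * y) * p + (k * c * x) * q) inflow rates ⟩
    RHS + (c * b * a * k′ * y) * 0ℚ + (k * c * x) * 0ℚ
      ≡⟨ solve 3 (λ R p q → R :+ p :* con 0ℚ :+ q :* con 0ℚ := R) refl RHS (c * b * a * k′ * y) (k * c * x) ⟩
    RHS ∎
    where
    open ≡-Reasoning
    m = suc n
    a = 1/ℕ m
    b = 1/ℕ (suc m)
    k = toℚ (i ℕ.+ j)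
    c = rate j
    k′ = toℚ (i ℕ.+ pr j)
    c′ = rate (pr j)
    μ = splitCount j
    x = count m j
    y = count m (pr j)
    RHS = k * c * x * a + c * b * (k′ * c′ * y * a - k * c * x * a)
    inflow : k * μ - c′ ≡ 0ℚ
    inflow = trans (cong (_- c′) (inflow-rate j)) (+-inverseʳ c′)
    rates : b - a + a * b * (c - k) ≡ 0ℚ
    rates = begin
      b - a + a * b * (c - k)              ≡⟨ cong (λ z → b - a + a * b * (z - k)) (toℚ-homo-+ 1 (i ℕ.+ j)) ⟩
      b - a + a * b * ((1ℚ + k) - k)       ≡⟨ cong (λ z → b - a + z * ((1ℚ + k) - k)) (sym (1/ℕ-suc-sub n)) ⟩
      b - a + (a - b) * ((1ℚ + k) - k)     ≡⟨ solve 3 (λ a b k → b :- a :+ (a :- b) :* ((con 1ℚ :+ k) :- k) := con 0ℚ) refl a b k ⟩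
      0ℚ                                   ∎

  count-split-zero : count M₀ 0 ≡ 1ℚ + 1ℚ
  count-split-zero rewrite dist-split | isSize-≡ 0 (i ℕ.* r) (proj₂ (proj₂ ir-admissible)) = refl

  count-split-suc : ∀ j → count M₀ (suc j) ≡ 0ℚ
  count-split-suc j rewrite dist-split | isSize-≢ (suc j) 0 (i ℕ.* r) (proj₂ (proj₂ ir-admissible)) (λ ()) = refl

  normalized-mass : Σ i (λ j → 1/ℕ (suc (i ℕ.+ j)) * normalized M₀ j) ≡ 1ℚ
  normalized-mass = trans (Σ-single i _ 0 (s≤s z≤n) others) at-zero
    where
    open ≡-Reasoning
    others : ∀ j → j ℕ.< i → j ≢ 0 → 1/ℕ (suc (i ℕ.+ j)) * normalized M₀ j ≡ 0ℚ
    others zero    _ 0≢0 = ⊥-elim (0≢0 refl)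
    others (suc j) _ _   rewrite count-split-suc j =
      solve 4 (λ w k c a → w :* (k :* c :* con 0ℚ :* a) := con 0ℚ) refl (1/ℕ (suc (i ℕ.+ suc j))) (toℚ (i ℕ.+ suc j)) (rate (suc j)) (1/ℕ M₀)
    at-zero : 1/ℕ (suc (i ℕ.+ 0)) * normalized M₀ 0 ≡ 1ℚ
    at-zero = begin
      1/ℕ (suc (i ℕ.+ 0)) * (toℚ (i ℕ.+ 0) * rate 0 * count M₀ 0 * 1/ℕ M₀)
        ≡⟨ cong (λ z → 1/ℕ (suc (i ℕ.+ 0)) * (toℚ (i ℕ.+ 0) * rate 0 * z * 1/ℕ M₀)) count-split-zero ⟩
      1/ℕ (suc (i ℕ.+ 0)) * (toℚ (i ℕ.+ 0) * rate 0 * (1ℚ + 1ℚ) * 1/ℕ M₀)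
        ≡⟨ solve 5 (λ w k c t a → w :* (k :* c :* t :* a) := (w :* c) :* ((k :* t) :* a)) refl (1/ℕ (suc (i ℕ.+ 0))) (toℚ (i ℕ.+ 0)) (rate 0) (1ℚ + 1ℚ) (1/ℕ M₀) ⟩
      (1/ℕ (suc (i ℕ.+ 0)) * rate 0) * ((toℚ (i ℕ.+ 0) * (1ℚ + 1ℚ)) * 1/ℕ M₀)
        ≡⟨ cong₂ (λ p q → p * (q * 1/ℕ M₀)) (1/ℕ*toℚ≡1 (suc (i ℕ.+ 0))) (inflow-rate 0) ⟩
      1ℚ * (toℚ M₀ * 1/ℕ M₀)
        ≡⟨ cong (1ℚ *_) (toℚ*1/ℕ≡1 M₀) ⟩
      1ℚ * 1ℚ
        ≡⟨ *-identityˡ 1ℚ ⟩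
      1ℚ ∎

  blockWeight : ℕ → ℚ
  blockWeight j = 1/ℕ (i ℕ.+ j) * 1/ℕ (suc (i ℕ.+ j))

  count≡normalized : ∀ n j → count (suc n) j ≡ toℚ (suc n) * (blockWeight j * normalized (suc n) j)
  count≡normalized n j = sym (begin
    toℚ (suc n) * ((1/ℕ (i ℕ.+ j) * 1/ℕ (suc (i ℕ.+ j))) * (k * c * x * 1/ℕ (suc n)))
      ≡⟨ solve 7 (λ t p q k c x a → t :* ((p :* q) :* (k :* c :* x :* a)) := x :* (t :* a) :* (k :* p) :* (c :* q)) refl
           (toℚ (suc n)) (1/ℕ (i ℕ.+ j)) (1/ℕ (suc (i ℕ.+ j))) k c x (1/ℕ (suc n)) ⟩
    x * (toℚ (suc n) * 1/ℕ (suc n)) * (k * 1/ℕ (i ℕ.+ j)) * (c * 1/ℕ (suc (i ℕ.+ j)))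
      ≡⟨ cong₂ (λ p q → x * p * q * (c * 1/ℕ (suc (i ℕ.+ j)))) (toℚ*1/ℕ≡1 (suc n)) (toℚ*1/ℕ≡1 (i ℕ.+ j)) ⟩
    x * 1ℚ * 1ℚ * (c * 1/ℕ (suc (i ℕ.+ j)))
      ≡⟨ cong (λ z → x * 1ℚ * 1ℚ * z) (toℚ*1/ℕ≡1 (suc (i ℕ.+ j))) ⟩
    x * 1ℚ * 1ℚ * 1ℚ
      ≡⟨ solve 1 (λ x → x :* con 1ℚ :* con 1ℚ :* con 1ℚ := x) refl x ⟩
    x ∎)
    where
    open ≡-Reasoning
    k = toℚ (i ℕ.+ j)
    c = rate j
    x = count (suc n) j

  expBlocks≡normalized : ∀ n → M₀ ℕ.≤ suc n → expBlocks B r (suc n) ≡ toℚ (suc n) * Σ i (λ j → blockWeight j * normalized (suc n) j)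
  expBlocks≡normalized n M₀≤m = begin
    expBlocks B r (suc n)                                     ≡⟨ expBlocks≡expect B r (suc n) ⟩
    expect (λ _ → 1ℚ) (dist B r (suc n))                      ≡⟨ expect-admissible (λ _ → 1ℚ) (dist B r (suc n)) (dist-admissible (suc n) M₀≤m) ⟩
    Σ i (λ j → 1ℚ * count (suc n) j)                          ≡⟨ Σ-cong i (λ j _ → trans (*-identityˡ _) (count≡normalized n j)) ⟩
    Σ i (λ j → toℚ (suc n) * (blockWeight j * normalized (suc n) j)) ≡⟨ Σ-*ˡ i (toℚ (suc n)) _ ⟩
    toℚ (suc n) * Σ i (λ j → blockWeight j * normalized (suc n) j) ∎
    where open ≡-Reasoning

module Fullness (B i′ r′ : ℕ) (fits : (suc i′ ℕ.+ i′) ℕ.* suc r′ ℕ.≤ B)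
                (overflows : B ℕ.< (suc i′ ℕ.+ suc i′) ℕ.* suc r′) where

  open RationalFacts
  open FiniteSums
  open Limits
  open Cycles
  open Blocks
  open import Data.Nat as ℕ using (ℕ; suc)
  import Data.Nat.Properties as ℕ
  open import Data.Rational
  open import Data.Rational.Properties
  open import Relation.Binary.PropositionalEquality
  open import Data.Product using (_,_)
  open import Data.Rational.Solver using (module +-*-Solver)
  open +-*-Solver

  open Process B i′ r′ fits overflows
  open ExpectedCounts B i′ r′ fits overflows
  open CyclicAveraging i′ normalized M₀ normalized-step normalized-mass using (Z; Z-nonZero; Z⁻¹; Z⁻¹-pos; functional→limit)

  instance
    B-nonZero : ℕ.NonZero B
    B-nonZero = ℕ.>-nonZero (ℕ.<-≤-trans ℕ.z<s fits)

  Y : ℕ → ℚ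
  Y m = Σ i (λ j → blockWeight j * normalized m j)

  y* : ℚ
  y* = Z⁻¹ * Σ i blockWeight

  blockWeight²≤weight : ∀ j → j ℕ.< i → blockWeight j * blockWeight j ≤ 1/ℕ (suc (i ℕ.+ j))
  blockWeight²≤weight j _ = begin
    (a * w) * (a * w)   ≡⟨ solve 2 (λ a w → (a :* w) :* (a :* w) := (a :* a) :* w :* w) refl a w ⟩
    (a * a) * w * w     ≤⟨ *-monoʳ-≤-0≤ w (1/ℕ-nonNeg (i ℕ.+ j)) (*-monoʳ-≤-0≤ w (1/ℕ-nonNeg (i ℕ.+ j)) a²≤1) ⟩
    1ℚ * w * w          ≤⟨ *-monoˡ-≤-0≤ (1ℚ * w) (subst (0ℚ ≤_) (sym (*-identityˡ w)) (1/ℕ-nonNeg (i ℕ.+ j))) (1/ℕ≤1 (i ℕ.+ j)) ⟩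
    1ℚ * w * 1ℚ         ≡⟨ solve 1 (λ w → con 1ℚ :* w :* con 1ℚ := w) refl w ⟩
    w                   ∎
    where
    open ≤-Reasoning
    a = 1/ℕ (i ℕ.+ j)
    w = 1/ℕ (suc (i ℕ.+ j))
    a²≤1 : a * a ≤ 1ℚ
    a²≤1 = *-mono-≤-0≤ (1/ℕ-nonNeg (i′ ℕ.+ j)) (1/ℕ-nonNeg (i′ ℕ.+ j)) (1/ℕ≤1 (i′ ℕ.+ j)) (1/ℕ≤1 (i′ ℕ.+ j))

  y*-pos : 0ℚ < y*
  y*-pos = *-pos Z⁻¹ _ Z⁻¹-pos (+-mono-≤-< (Σ-nonNeg i′ (λ j _ → <⇒≤ (blockWeight-pos j))) (blockWeight-pos i′))
    where
    blockWeight-pos : ∀ j → 0ℚ < blockWeight j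
    blockWeight-pos j = *-pos _ _ (1/ℕ-pos (i′ ℕ.+ j)) (1/ℕ-pos (i ℕ.+ j))

  -- Σ_{j<i} 1/((i+j)(i+j+1)) = 1/i − 1/(2i) = 1/(2i).
  y*-2iZ : y* * (toℚ (i ℕ.+ i) * Z) ≡ 1ℚ
  y*-2iZ = begin
    Z⁻¹ * Σ i blockWeight * (toℚ (i ℕ.+ i) * Z)
      ≡⟨ cong (λ z → Z⁻¹ * z * (toℚ (i ℕ.+ i) * Z)) (Σ-reciprocal-telescope i′ i) ⟩
    Z⁻¹ * (1/ℕ i - 1/ℕ (i ℕ.+ i)) * (toℚ (i ℕ.+ i) * Z)
      ≡⟨ solve 5 (λ z a b t Z → z :* (a :- b) :* (t :* Z) := (z :* Z) :* (a :* t :- b :* t)) refl Z⁻¹ (1/ℕ i) (1/ℕ (i ℕ.+ i)) (toℚ (i ℕ.+ i)) Z ⟩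
    (Z⁻¹ * Z) * (1/ℕ i * toℚ (i ℕ.+ i) - 1/ℕ (i ℕ.+ i) * toℚ (i ℕ.+ i))
      ≡⟨ cong₂ (λ u z → u * (z - 1/ℕ (i ℕ.+ i) * toℚ (i ℕ.+ i))) (*-inverseˡ Z) 1/i*2i≡2 ⟩
    1ℚ * ((1ℚ + 1ℚ) - 1/ℕ (i ℕ.+ i) * toℚ (i ℕ.+ i))
      ≡⟨ cong (λ z → 1ℚ * ((1ℚ + 1ℚ) - z)) (1/ℕ*toℚ≡1 (i ℕ.+ i)) ⟩
    1ℚ * ((1ℚ + 1ℚ) - 1ℚ)
      ≡⟨ solve 0 (con 1ℚ :* ((con 1ℚ :+ con 1ℚ) :- con 1ℚ) := con 1ℚ) refl ⟩
    1ℚ ∎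
    where
    open ≡-Reasoning
    1/i*2i≡2 : 1/ℕ i * toℚ (i ℕ.+ i) ≡ 1ℚ + 1ℚ
    1/i*2i≡2 = trans (cong (1/ℕ i *_) (toℚ-homo-+ i i)) (trans (*-distribˡ-+ (1/ℕ i) (toℚ i) (toℚ i)) (cong₂ _+_ (1/ℕ*toℚ≡1 i) (1/ℕ*toℚ≡1 i)))

  ρ L : ℚ
  ρ = toℚ r * 1/ℕ B
  L = toℚ (2 ℕ.* i ℕ.* r) * 1/ℕ B * Z

  L*y*≡ρ : L * y* ≡ ρ
  L*y*≡ρ = begin
    toℚ (2 ℕ.* i ℕ.* r) * 1/ℕ B * Z * y*
      ≡⟨ cong (λ z → z * 1/ℕ B * Z * y*) (trans (cong toℚ 2ir≡) (toℚ-homo-* (i ℕ.+ i) r)) ⟩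
    toℚ (i ℕ.+ i) * toℚ r * 1/ℕ B * Z * y*
      ≡⟨ solve 5 (λ t r b Z y → t :* r :* b :* Z :* y := r :* b :* (y :* (t :* Z))) refl (toℚ (i ℕ.+ i)) (toℚ r) (1/ℕ B) Z y* ⟩
    ρ * (y* * (toℚ (i ℕ.+ i) * Z))
      ≡⟨ cong (ρ *_) y*-2iZ ⟩
    ρ * 1ℚ
      ≡⟨ *-identityʳ ρ ⟩
    ρ ∎
    where
    open ≡-Reasoning
    2ir≡ : 2 ℕ.* i ℕ.* r ≡ (i ℕ.+ i) ℕ.* r
    2ir≡ = cong (λ n → (i ℕ.+ n) ℕ.* r) (ℕ.+-identityʳ i)

  fullness*Y≡ρ : ∀ m → M₀ ℕ.≤ m → 0ℚ < Y m → fullnessAfter B r m * Y m ≡ ρ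
  fullness*Y≡ρ (suc n) M₀≤m 0<Y = begin
    f * Y m
      ≡⟨ sym (trans (cong (f * Y m *_) (cong₂ _*_ (toℚ*1/ℕ≡1 B) (toℚ*1/ℕ≡1 m))) (*-identityʳ (f * Y m))) ⟩
    f * Y m * ((toℚ B * 1/ℕ B) * (toℚ m * 1/ℕ m))
      ≡⟨ solve 6 (λ f Y b b⁻¹ t t⁻¹ → f :* Y :* ((b :* b⁻¹) :* (t :* t⁻¹)) := (f :* (b :* (t :* Y))) :* (b⁻¹ :* t⁻¹))
           refl f (Y m) (toℚ B) (1/ℕ B) (toℚ m) (1/ℕ m) ⟩
    (f * q) * (1/ℕ B * 1/ℕ m)
      ≡⟨ cong (_* (1/ℕ B * 1/ℕ m)) f*q≡mr ⟩
    toℚ (m ℕ.* r) * (1/ℕ B * 1/ℕ m)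
      ≡⟨ cong (_* (1/ℕ B * 1/ℕ m)) (toℚ-homo-* m r) ⟩
    toℚ m * toℚ r * (1/ℕ B * 1/ℕ m)
      ≡⟨ solve 4 (λ t R b⁻¹ t⁻¹ → t :* R :* (b⁻¹ :* t⁻¹) := R :* b⁻¹ :* (t :* t⁻¹)) refl (toℚ m) (toℚ r) (1/ℕ B) (1/ℕ m) ⟩
    ρ * (toℚ m * 1/ℕ m)
      ≡⟨ trans (cong (ρ *_) (toℚ*1/ℕ≡1 m)) (*-identityʳ ρ) ⟩
    ρ ∎
    where
    open ≡-Reasoning
    m = suc n
    f = fullnessAfter B r m
    q = toℚ B * (toℚ m * Y m)
    0<q : 0ℚ < q
    0<q = *-pos (toℚ B) _ (toℚ-mono-< (ℕ.<-≤-trans ℕ.z<s fits)) (*-pos (toℚ m) (Y m) (toℚ-pos n) 0<Y)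
    f*q≡mr : f * q ≡ toℚ (m ℕ.* r)
    f*q≡mr = trans (cong (λ z → (toℚ (m ℕ.* r) ÷? (toℚ B * z)) * q) (expBlocks≡normalized n M₀≤m)) (÷?-*-cancel _ q 0<q)

  fullness→L : ExpectedFinalFullness B r L
  fullness→L = quotient-converges (fullnessAfter B r) Y L y* y*-pos
    (functional→limit blockWeight blockWeight²≤weight) (M₀ , fullness*Y≡L*y*)
    where
    fullness*Y≡L*y* : ∀ m → M₀ ℕ.≤ m → 0ℚ < Y m → fullnessAfter B r m * Y m ≡ L * y*
    fullness*Y≡L*y* m M₀≤m 0<Y = trans (fullness*Y≡ρ m M₀≤m 0<Y) (sym L*y*≡ρ)

  Z≡H : Z ≡ H (2 ℕ.* i) - H i
  Z≡H = trans (Σ-harmonic i i) (cong (λ n → H (i ℕ.+ n) - H i) (sym (ℕ.+-identityʳ i)))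

open RationalFacts using (÷?-toℚ)
open import Data.Nat using (zero; _+_; _*_; _<_; _≤_; _∸_)
import Data.Nat.Properties as ℕ
open import Data.Rational using (_-_)
import Data.Rational as ℚ
open import Relation.Binary.PropositionalEquality using (_≡_; sym; trans; cong; cong₂; subst)
open import Data.Empty using (⊥-elim)

lemma16 : (B i r : ℕ) → 0 < B → 0 < i → B < 2 * i * r → (2 * i ∸ 1) * r ≤ B →
    ExpectedFinalFullness B r ((toℚ (2 * i * r) ÷? toℚ B) ℚ.* (H (2 * i) - H i))
lemma16 B zero     r       _ () _ _
lemma16 B (suc i′) zero    _ _ B<0 _ = ⊥-elim (ℕ.n≮0 (subst (B <_) (ℕ.*-zeroʳ (2 * suc i′)) B<0))
-- The hypothesis 0 < B is implied by (2i − 1) r ≤ B once i and r are positive.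
lemma16 B (suc i′) (suc r′) _ _ B<2ir [2i-1]r≤B = subst (ExpectedFinalFullness B (suc r′)) (sym limit≡L) fullness→L
  where
  fits : (suc i′ + i′) * suc r′ ≤ B
  fits = subst (λ n → n * suc r′ ≤ B) 2i-1≡ [2i-1]r≤B
    where
    2i-1≡ : 2 * suc i′ ∸ 1 ≡ suc i′ + i′
    2i-1≡ = trans (ℕ.+-suc i′ (i′ + 0)) (cong (λ n → suc (i′ + n)) (ℕ.+-identityʳ i′))
  overflows : B < (suc i′ + suc i′) * suc r′
  overflows = subst (λ n → B < n * suc r′) (cong (suc i′ +_) (ℕ.+-identityʳ (suc i′))) B<2ir
  open Fullness B i′ r′ fits overflows using (L; fullness→L; Z≡H; B-nonZero)
  limit≡L : (toℚ (2 * suc i′ * suc r′) ÷? toℚ B) ℚ.* (H (2 * suc i′) - H (suc i′)) ≡ L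
  limit≡L = cong₂ ℚ._*_ (÷?-toℚ (toℚ (2 * suc i′ * suc r′)) B) (sym Z≡H)
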